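{- For every positive integer $n$, $\mathrm{HB}_4(n)\ge n-\sqrt{3n-3}-4$.
   Context: A partial word over an alphabet $A$ is a finite word over $A\cup\{\diamondsuit\}$, $\diamondsuit\notin A$ a hole symbol. Two partial words of equal length are compatible if they agree at every position where both have letters. A partial word is unbordered if no nonempty proper prefix is compatible with the proper suffix of the same length. $\mathrm{HB}_4(n)$ is the maximum number of holes an unbordered partial word of length $n$ over an alphabet of size $4$ can have. -}

module Defs where

open import Data.Nat using (ℕ; zero; suc; _+_; _*_; _∸_; _≤_; _<_)
open import Data.Fin using (Fin)
open import Data.Maybe using (Maybe; just; nothing)
open import Data.List using (List; []; _∷_; length; take; drop)
open import Data.List.Relation.Binary.Pointwise using (Pointwise)
open import Data.Sum using (_⊎_)
open import Data.Product using (Σ; _×_)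
open import Relation.Binary.PropositionalEquality using (_≡_)
open import Relation.Nullary using (¬_)

-- A partial word over alphabet A: a finite word over A ∪ {◇},
-- where the hole symbol ◇ is represented by `nothing`.
PartialWord : Set → Set
PartialWord A = List (Maybe A)

SymCompat : {A : Set} → Maybe A → Maybe A → Set
SymCompat x y = (x ≡ nothing) ⊎ ((y ≡ nothing) ⊎ (x ≡ y))

Compatible : {A : Set} → PartialWord A → PartialWord A → Set
Compatible = Pointwise SymCompat

Unbordered : {A : Set} → PartialWord A → Set
Unbordered w = ∀ k → 1 ≤ k → k < length w →
  ¬ Compatible (take k w) (drop (length w ∸ k) w)

holes : {A : Set} → PartialWord A → ℕ
holes [] = 0
holes (nothing ∷ w) = suc (holes w)
holes (just _ ∷ w) = holes w

A4 : Set
A4 = Fin 4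

-- "HB₄(n) ≥ h": some unbordered partial word of length n over a
-- 4-letter alphabet has at least h holes (HB₄(n) is the maximum).
HB4-atLeast : ℕ → ℕ → Set
HB4-atLeast n h = Σ (PartialWord A4) λ w →
  (length w ≡ n) × (Unbordered w × (h ≤ holes w))

-- The real inequality  x ≥ n - √(3n-3) - 4  for natural x and n ≥ 1,
-- stated without reals: with d = n ∸ (x + 4) (truncated), it is
-- equivalent to d * d ≤ 3n - 3.
BoundHolds : ℕ → ℕ → Set
BoundHolds n x = (n ∸ (x + 4)) * (n ∸ (x + 4)) ≤ 3 * n ∸ 3

-- Write the word as the values w₀ … w_N of a position function. It is unbordered as soon as
-- every shift d ∈ [1, N] is witnessed by two positions at distance d carrying different
-- letters, so it suffices to place few letters with this property and fill the rest with holes.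
-- The letters form a Wichmann ruler with r = 2ρ, coloured so that each of its differences is
-- realised by two distinct letters, followed by C's every r + 1 positions counted back from N,
-- which meet the initial block B A^r at every shift beyond the ruler. With ρ = ⌊√(N/48)⌋ and as
-- many gaps of length 4r + 3 as fit, there are at most √(3N) + 4 letters once N ≥ 432; smaller
-- N are checked by evaluation, using the block B A^⌊√N⌋ alone as core when N < 200.

module Submission where

open import Defs
open import Data.Nat using (ℕ; zero; suc; _+_; _*_; _∸_; _⊓_; _≤_; _<_; z≤n; s≤s; z<s; NonZero; _%_; _/_; _≟_; _≤?_; _<?_)
open import Data.Nat.Properties
open import Data.Nat.DivMod using (m≡m%n+[m/n]*n; m%n<n; m/n*n≤m; m*n%n≡0; [m+kn]%n≡m%n; m<n⇒m%n≡m)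
open import Data.Nat.Tactic.RingSolver using (solve-∀)
open import Algebra.Properties.CommutativeSemigroup +-commutativeSemigroup using (xy∙z≈xz∙y; x∙yz≈y∙xz; x∙yz≈xz∙y)
open import Data.Fin using (Fin; toℕ; fromℕ<) renaming (zero to fz; suc to fs)
open import Data.Fin.Properties using (all?; toℕ-fromℕ<)
open import Data.Maybe using (Maybe; just; nothing)
open import Data.List using ([]; _∷_; length; take; drop; _++_)
open import Data.List.Relation.Binary.Pointwise using (Pointwise; []; _∷_)
open import Data.Bool using (if_then_else_)
open import Data.Product using (Σ; _×_; _,_; proj₁; proj₂)
open import Data.Sum using (_⊎_; inj₁; inj₂; [_,_]′)
open import Function using (_∘_; id)
open import Relation.Binary.PropositionalEquality
open import Relation.Nullary using (¬_; Dec; does; yes; no; contradiction)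
open import Relation.Nullary.Decidable using (dec-true; dec-false; toWitness)

-- Partial words given by position functions

module _ {X : Set} where

  segment : (ℕ → Maybe X) → ℕ → ℕ → PartialWord X
  segment f a zero = []
  segment f a (suc k) = f a ∷ segment f (suc a) k

  length-segment : ∀ f a k → length (segment f a k) ≡ k
  length-segment f a zero = refl
  length-segment f a (suc k) = cong suc (length-segment f (suc a) k)

  take-segment : ∀ f a {k m} → k ≤ m → take k (segment f a m) ≡ segment f a k
  take-segment f a {zero} _ = refl
  take-segment f a {suc k} (s≤s k≤m) = cong (f a ∷_) (take-segment f (suc a) k≤m)

  segment-++ : ∀ f a k l → segment f a (k + l) ≡ segment f a k ++ segment f (a + k) l
  segment-++ f a zero l = cong (λ b → segment f b l) (sym (+-identityʳ a))
  segment-++ f a (suc k) l = cong (f a ∷_)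
    (trans (segment-++ f (suc a) k l) (cong (λ b → segment f (suc a) k ++ segment f b l) (sym (+-suc a k))))

  segment-cong : ∀ f g a k → (∀ j → j < k → f (a + j) ≡ g (a + j)) → segment f a k ≡ segment g a k
  segment-cong f g a zero _ = refl
  segment-cong f g a (suc k) f≗g = cong₂ _∷_
    (subst (λ p → f p ≡ g p) (+-identityʳ a) (f≗g 0 (s≤s z≤n)))
    (segment-cong f g (suc a) k λ j j<k → subst (λ p → f p ≡ g p) (+-suc a j) (f≗g (suc j) (s≤s j<k)))

  drop-segment : ∀ f a j k → drop j (segment f a (j + k)) ≡ segment f (a + j) k
  drop-segment f a zero k = cong (λ b → segment f b k) (sym (+-identityʳ a))
  drop-segment f a (suc j) k = trans (drop-segment f (suc a) j k) (cong (λ b → segment f b k) (sym (+-suc a j)))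

  Pointwise-segment : ∀ {R : Maybe X → Maybe X → Set} f a b k →
    Pointwise R (segment f a k) (segment f b k) → ∀ i → i < k → R (f (a + i)) (f (b + i))
  Pointwise-segment {R} f a b (suc k) (r ∷ _) zero _ =
    subst₂ (λ u v → R (f u) (f v)) (sym (+-identityʳ a)) (sym (+-identityʳ b)) r
  Pointwise-segment {R} f a b (suc k) (_ ∷ rs) (suc i) (s≤s i<k) =
    subst₂ (λ u v → R (f u) (f v)) (sym (+-suc a i)) (sym (+-suc b i)) (Pointwise-segment f (suc a) (suc b) k rs i i<k)

  distinct-incompatible : ∀ {a b : X} → a ≢ b → ¬ SymCompat (just a) (just b)
  distinct-incompatible a≢b (inj₁ ())
  distinct-incompatible a≢b (inj₂ (inj₁ ()))
  distinct-incompatible a≢b (inj₂ (inj₂ refl)) = a≢b refl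

  LetterOtherThan : (ℕ → Maybe X) → ℕ → X → Set
  LetterOtherThan f p b = Σ X λ a → f p ≡ just a × a ≢ b

  Mismatch : (ℕ → Maybe X) → ℕ → ℕ → Set
  Mismatch f N d = Σ ℕ λ x → x + d ≤ N × ¬ SymCompat (f x) (f (x + d))

  Covers : (ℕ → Maybe X) → ℕ → Set
  Covers f N = ∀ d → 1 ≤ d → d ≤ N → Mismatch f N d

  mismatch : ∀ {f N d y b} x → x + d ≡ y → y ≤ N → LetterOtherThan f x b → f y ≡ just b → Mismatch f N d
  mismatch x refl y≤N (a , fx≡a , a≢b) fy≡b =
    x , y≤N , subst₂ (λ u v → ¬ SymCompat u v) (sym fx≡a) (sym fy≡b) (distinct-incompatible a≢b)

  -- A border of length k of a word of length N + 1 is a self-overlap at shift N + 1 ∸ k.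
  segment-unbordered : ∀ f N → Covers f N → Unbordered (segment f 0 (suc N))
  segment-unbordered f N cover k 1≤k k<len border = no-mismatch (cover d 1≤d d≤N)
    where
      k<1+N : k < suc N
      k<1+N = subst (k <_) (length-segment f 0 (suc N)) k<len
      d : ℕ
      d = suc N ∸ k
      1≤d : 1 ≤ d
      1≤d = m<n⇒0<n∸m k<1+N
      d≤N : d ≤ N
      d≤N = ∸-monoʳ-≤ (suc N) 1≤k
      d+k≡1+N : d + k ≡ suc N
      d+k≡1+N = m∸n+n≡m (<⇒≤ k<1+N)
      prefix : take k (segment f 0 (suc N)) ≡ segment f 0 k
      prefix = take-segment f 0 (<⇒≤ k<1+N)
      suffix : drop d (segment f 0 (suc N)) ≡ segment f d k
      suffix = trans (cong (λ n → drop d (segment f 0 n)) (sym d+k≡1+N)) (drop-segment f 0 d k)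
      aligned : Compatible (segment f 0 k) (segment f d k)
      aligned = subst₂ Compatible prefix suffix
        (subst (λ n → Compatible (take k (segment f 0 (suc N))) (drop (n ∸ k) (segment f 0 (suc N))))
          (length-segment f 0 (suc N)) border)
      no-mismatch : ¬ Mismatch f N d
      no-mismatch (x , x+d≤N , incompatible) =
        incompatible (subst (λ y → SymCompat (f x) (f y)) (+-comm d x) (Pointwise-segment f 0 d k aligned x x<k))
        where
          x<k : x < k
          x<k = +-cancelʳ-< d x k (subst (x + d <_) (trans (sym d+k≡1+N) (+-comm d k)) (s≤s x+d≤N))

  letters : PartialWord X → ℕ
  letters [] = 0
  letters (nothing ∷ w) = letters w
  letters (just _ ∷ w) = suc (letters w)

  holes+letters : ∀ w → holes w + letters w ≡ length w
  holes+letters [] = refl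
  holes+letters (nothing ∷ w) = cong suc (holes+letters w)
  holes+letters (just _ ∷ w) = trans (+-suc (holes w) (letters w)) (cong suc (holes+letters w))

  letters-++ : ∀ (u v : PartialWord X) → letters (u ++ v) ≡ letters u + letters v
  letters-++ [] v = refl
  letters-++ (nothing ∷ u) v = letters-++ u v
  letters-++ (just _ ∷ u) v = cong suc (letters-++ u v)

  letters-segment-++ : ∀ f a k l →
    letters (segment f a (k + l)) ≡ letters (segment f a k) + letters (segment f (a + k) l)
  letters-segment-++ f a k l = trans (cong letters (segment-++ f a k l)) (letters-++ (segment f a k) _)

  letters-segment-≤ : ∀ f a k → letters (segment f a k) ≤ k
  letters-segment-≤ f a zero = z≤n
  letters-segment-≤ f a (suc k) with f a
  ... | nothing = ≤-trans (letters-segment-≤ f (suc a) k) (n≤1+n k)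
  ... | just _ = s≤s (letters-segment-≤ f (suc a) k)

  HolesOn : (ℕ → Maybe X) → ℕ → ℕ → Set
  HolesOn f a k = ∀ j → j < k → f (a + j) ≡ nothing

  HolesExcept : (ℕ → Maybe X) → ℕ → ℕ → ℕ → Set
  HolesExcept f a m o = ∀ j → j < m → j ≢ o → f (a + j) ≡ nothing

  private
    letters-hole-∷ : ∀ {x} (w : PartialWord X) → x ≡ nothing → letters (x ∷ w) ≡ letters w
    letters-hole-∷ w refl = refl

    letters-∷ : ∀ x (w : PartialWord X) → letters (x ∷ w) ≤ suc (letters w)
    letters-∷ nothing w = n≤1+n (letters w)
    letters-∷ (just _) w = ≤-refl

    shift-suc : ∀ (f : ℕ → Maybe X) a {j} → f (a + suc j) ≡ nothing → f (suc a + j) ≡ nothing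
    shift-suc f a {j} = subst (λ p → f p ≡ nothing) (+-suc a j)

    at-start : ∀ (f : ℕ → Maybe X) a → f (a + 0) ≡ nothing → f a ≡ nothing
    at-start f a = subst (λ p → f p ≡ nothing) (+-identityʳ a)

  letters-segment-holes : ∀ f a k → HolesOn f a k → letters (segment f a k) ≡ 0
  letters-segment-holes f a zero _ = refl
  letters-segment-holes f a (suc k) hole = trans (letters-hole-∷ _ (at-start f a (hole 0 (s≤s z≤n))))
    (letters-segment-holes f (suc a) k λ j j<k → shift-suc f a (hole (suc j) (s≤s j<k)))

  letters-segment-except : ∀ f a m o → HolesExcept f a m o → letters (segment f a m) ≤ 1
  letters-segment-except f a zero o _ = z≤n
  letters-segment-except f a (suc m) zero hole = ≤-trans (letters-∷ (f a) _)
    (s≤s (≤-reflexive (letters-segment-holes f (suc a) m λ j j<m → shift-suc f a (hole (suc j) (s≤s j<m) λ ()))))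
  letters-segment-except f a (suc m) (suc o) hole = ≤-trans (≤-reflexive (letters-hole-∷ _ (at-start f a (hole 0 (s≤s z≤n) λ ()))))
    (letters-segment-except f (suc a) m o λ j j<m j≢o → shift-suc f a (hole (suc j) (s≤s j<m) (j≢o ∘ suc-injective)))

  letters-segment-blocks : ∀ f a m o K → (∀ t → t < K → HolesExcept f (a + t * m) m o) →
                           letters (segment f a (K * m)) ≤ K
  letters-segment-blocks f a m o zero _ = z≤n
  letters-segment-blocks f a m o (suc K) block = begin
    letters (segment f a (m + K * m))                                 ≡⟨ letters-segment-++ f a m (K * m) ⟩
    letters (segment f a m) + letters (segment f (a + m) (K * m))     ≤⟨ +-mono-≤ first rest ⟩
    1 + K                                                             ∎
    where
      open ≤-Reasoning
      first : letters (segment f a m) ≤ 1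
      first = letters-segment-except f a m o λ j j<m j≢o →
        subst (λ p → f (p + j) ≡ nothing) (+-identityʳ a) (block 0 (s≤s z≤n) j j<m j≢o)
      rest : letters (segment f (a + m) (K * m)) ≤ K
      rest = letters-segment-blocks f (a + m) m o K λ t t<K j j<m j≢o →
        subst (λ p → f (p + j) ≡ nothing) (sym (+-assoc a m (t * m))) (block (suc t) (s≤s t<K) j j<m j≢o)

if-yes : ∀ {Y P : Set} (P? : Dec P) {x y : Y} → P → (if does P? then x else y) ≡ x
if-yes P? p = cong (λ b → if b then _ else _) (dec-true P? p)

if-no : ∀ {Y P : Set} (P? : Dec P) {x y : Y} → ¬ P → (if does P? then x else y) ≡ y
if-no P? ¬p = cong (λ b → if b then _ else _) (dec-false P? ¬p)

module _ {X : Set} where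

  periodic : (m : ℕ) .{{_ : NonZero m}} → X → ℕ → Maybe X
  periodic m c j = if does (j % m ≟ 0) then just c else nothing

  periodic-mark : ∀ m .{{_ : NonZero m}} c u → periodic m c (u * m) ≡ just c
  periodic-mark m c u = if-yes (u * m % m ≟ 0) (m*n%n≡0 u m)

  periodic-gap : ∀ m .{{_ : NonZero m}} c u {v} → 1 ≤ v → v < m → periodic m c (u * m + v) ≡ nothing
  periodic-gap m c u {v} 1≤v v<m = if-no (_ ≟ 0) λ rem≡0 → <⇒≢ 1≤v (sym (trans (sym rem≡v) rem≡0))
    where
      rem≡v : (u * m + v) % m ≡ v
      rem≡v = trans (cong (_% m) (+-comm (u * m) v)) (trans ([m+kn]%n≡m%n v u m) (m<n⇒m%n≡m v<m))

-- Extending a core by periodic C's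

A B C D : A4
A = fz
B = fs fz
C = fs (fs fz)
D = fs (fs (fs fz))

covering-HB4 : ∀ (f : ℕ → Maybe A4) N L → Covers f N → letters (segment f 0 (suc N)) ≤ L →
  HB4-atLeast (suc N) (suc N ∸ L)
covering-HB4 f N L covers few = segment f 0 (suc N) , length-segment f 0 (suc N) , segment-unbordered f N covers ,
  ≤-trans (∸-monoʳ-≤ (suc N) few) (≤-reflexive (begin
    suc N ∸ letters w                      ≡⟨ cong (_∸ letters w) (length-segment f 0 (suc N)) ⟨
    length w ∸ letters w                   ≡⟨ cong (_∸ letters w) (holes+letters w) ⟨
    holes w + letters w ∸ letters w        ≡⟨ m+n∸n≡m (holes w) (letters w) ⟩
    holes w                                ∎))
  where
    open ≡-Reasoning
    w : PartialWord A4
    w = segment f 0 (suc N)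

extensionLetters : ℕ → ℕ → ℕ
extensionLetters r δ = δ / suc r + δ % suc r ⊓ 1

extensionLetters-upper : ∀ r δ → suc r * extensionLetters r δ ≤ δ + suc r
extensionLetters-upper r δ = begin
  suc r * (δ / suc r + δ % suc r ⊓ 1)              ≡⟨ *-distribˡ-+ (suc r) (δ / suc r) _ ⟩
  suc r * (δ / suc r) + suc r * (δ % suc r ⊓ 1)    ≤⟨ +-mono-≤ (≤-trans (≤-reflexive (*-comm (suc r) (δ / suc r))) (m/n*n≤m δ (suc r)))
                                                        (≤-trans (*-monoʳ-≤ (suc r) (m⊓n≤n (δ % suc r) 1)) (≤-reflexive (*-identityʳ (suc r)))) ⟩
  δ + suc r                                        ∎
  where open ≤-Reasoning

extensionLetters-lower : ∀ r δ → δ + 1 ≤ (extensionLetters r δ + 1) * suc r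
extensionLetters-lower r δ = begin
  δ + 1                                  ≡⟨ +-comm δ 1 ⟩
  suc δ                                  ≡⟨ cong suc (m≡m%n+[m/n]*n δ (suc r)) ⟩
  suc (δ % suc r) + δ / suc r * suc r    ≤⟨ +-monoˡ-≤ (δ / suc r * suc r) (m%n<n δ (suc r)) ⟩
  suc (δ / suc r) * suc r                ≤⟨ *-monoˡ-≤ (suc r) (≤-trans (≤-reflexive (+-comm 1 (δ / suc r))) (+-monoˡ-≤ 1 (m≤m+n _ _))) ⟩
  (extensionLetters r δ + 1) * suc r     ∎
  where open ≤-Reasoning

extensionLetters-≤ : ∀ r δ m → δ < m * suc r → extensionLetters r δ ≤ m
extensionLetters-≤ r δ m δ<m[r+1] = ≤-trans (+-monoʳ-≤ (δ / suc r) (m⊓n≤n (δ % suc r) 1))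
  (≤-trans (≤-reflexive (+-comm (δ / suc r) 1))
    (*-cancelʳ-< (suc r) (δ / suc r) m (≤-<-trans (m/n*n≤m δ (suc r)) δ<m[r+1])))

module Extension (r N′ N : ℕ) (core : ℕ → Maybe A4) where

  extended : ℕ → Maybe A4
  extended p = if does (p ≤? N′) then core p else periodic (suc r) C (N ∸ p)

  extended-core : ∀ {p} → p ≤ N′ → extended p ≡ core p
  extended-core {p} = if-yes (p ≤? N′)

  extended-mark : ∀ {p} u → N′ < p → N ≡ p + u * suc r → extended p ≡ just C
  extended-mark {p} u N′<p N≡ = trans (if-no (p ≤? N′) (<⇒≱ N′<p))
    (trans (cong (periodic (suc r) C) (trans (cong (_∸ p) N≡) (m+n∸m≡n p _))) (periodic-mark (suc r) C u))

  extended-gap : ∀ {p} u v → N′ < p → N ≡ p + (u * suc r + v) → 1 ≤ v → v < suc r → extended p ≡ nothing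
  extended-gap {p} u v N′<p N≡ 1≤v v≤r = trans (if-no (p ≤? N′) (<⇒≱ N′<p))
    (trans (cong (periodic (suc r) C) (trans (cong (_∸ p) N≡) (m+n∸m≡n p _))) (periodic-gap (suc r) C u 1≤v v≤r))

  module _ (initial : ∀ i → i ≤ r → LetterOtherThan core i C) (r≤N′ : r ≤ N′) (N′≤N : N′ ≤ N)
           (core-covers : Covers core N′) where

    -- A shift d beyond the core pairs the letter at i = (N ∸ d) mod (r + 1) with the C at i + d.
    extended-covers : Covers extended N
    extended-covers d 1≤d d≤N with d ≤? N′
    ... | yes d≤N′ with core-covers d 1≤d d≤N′
    ... | x , x+d≤N′ , incompatible =
      x , ≤-trans x+d≤N′ N′≤N ,
      subst₂ (λ u v → ¬ SymCompat u v) (sym (extended-core (≤-trans (m≤m+n x d) x+d≤N′))) (sym (extended-core x+d≤N′)) incompatible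
    extended-covers d 1≤d d≤N | no d≰N′ =
      mismatch i refl (subst (i + d ≤_) (sym N≡) (m≤m+n (i + d) (t * suc r))) initial-letter
        (extended-mark t (<-≤-trans (≰⇒> d≰N′) (m≤n+m d i)) N≡)
      where
        i t : ℕ
        i = (N ∸ d) % suc r
        t = (N ∸ d) / suc r
        i≤r : i ≤ r
        i≤r = ≤-pred (m%n<n (N ∸ d) (suc r))
        N≡ : N ≡ i + d + t * suc r
        N≡ = begin
          N                    ≡⟨ m∸n+n≡m d≤N ⟨
          N ∸ d + d            ≡⟨ cong (_+ d) (m≡m%n+[m/n]*n (N ∸ d) (suc r)) ⟩
          i + t * suc r + d    ≡⟨ xy∙z≈xz∙y i (t * suc r) d ⟩
          i + d + t * suc r    ∎
          where open ≡-Reasoning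
        initial-letter : LetterOtherThan extended i C
        initial-letter with initial i i≤r
        ... | c , core-i , c≢C = c , trans (extended-core (≤-trans i≤r r≤N′)) core-i , c≢C

  module _ (N′≤N : N′ ≤ N) where

    private
      δ w K : ℕ
      δ = N ∸ N′
      w = δ % suc r
      K = δ / suc r

      w≤r : w ≤ r
      w≤r = ≤-pred (m%n<n δ (suc r))

      N′+δ≡N : N′ + (w + K * suc r) ≡ N
      N′+δ≡N = trans (cong (N′ +_) (sym (m≡m%n+[m/n]*n δ (suc r)))) (m+[n∸m]≡n N′≤N)

    -- The first w positions beyond the core end with the C at N ∸ K (r + 1).
    extended-letters-head : letters (segment extended (suc N′) w) ≤ w ⊓ 1
    extended-letters-head = ⊓-glb (letters-segment-≤ extended (suc N′) w) (letters-segment-except extended (suc N′) w (w ∸ 1) gap)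
      where
        gap : HolesExcept extended (suc N′) w (w ∸ 1)
        gap j j<w j≢w-1 with m≤n⇒m<n∨m≡n j<w
        ... | inj₂ j+1≡w = contradiction (cong (_∸ 1) j+1≡w) j≢w-1
        ... | inj₁ j+1<w with m≤n⇒∃[o]m+o≡n j+1<w
        ... | v , j+2+v≡w = extended-gap K (suc v) (s≤s (m≤m+n N′ j)) (trans (sym N′+δ≡N) lay-out) (s≤s z≤n)
                (s≤s (≤-trans (s≤s (m≤n+m v (suc j))) (≤-trans (≤-reflexive j+2+v≡w) w≤r)))
          where
            ring : ∀ N′ j v z → N′ + (suc (suc j) + v + z) ≡ suc N′ + j + (z + suc v)
            ring = solve-∀
            lay-out : N′ + (w + K * suc r) ≡ suc N′ + j + (K * suc r + suc v)
            lay-out = trans (cong (λ x → N′ + (x + K * suc r)) (sym j+2+v≡w)) (ring N′ j v (K * suc r))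

    extended-letters-tail : letters (segment extended (suc N′ + w) (K * suc r)) ≤ K
    extended-letters-tail = letters-segment-blocks extended (suc N′ + w) (suc r) r K gap
      where
        gap : ∀ t → t < K → HolesExcept extended (suc N′ + w + t * suc r) (suc r) r
        gap t t<K j j<1+r j≢r with m≤n⇒∃[o]m+o≡n t<K | m≤n⇒m<n∨m≡n j<1+r
        ... | _ | inj₂ j+1≡1+r = contradiction (suc-injective j+1≡1+r) j≢r
        ... | u , t+1+u≡K | inj₁ j<r with m≤n⇒∃[o]m+o≡n (≤-pred j<r)
        ... | v , j+1+v≡r = extended-gap u (suc v) N′<p (trans (sym N′+δ≡N) lay-out)
                (s≤s z≤n) (s≤s (≤-trans (s≤s (m≤n+m v j)) (≤-reflexive j+1+v≡r)))
          where
            open ≡-Reasoning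
            N′<p : N′ < suc N′ + w + t * suc r + j
            N′<p = ≤-trans (m≤m+n (suc N′) w) (≤-trans (m≤m+n _ (t * suc r)) (m≤m+n _ j))
            ring₁ : ∀ N′ w t u m → N′ + (w + (suc t + u) * suc m) ≡ N′ + w + t * suc m + suc m + u * suc m
            ring₁ = solve-∀
            ring₂ : ∀ N′ w x j v y → N′ + w + x + suc (suc j + v) + y ≡ suc N′ + w + x + j + (y + suc v)
            ring₂ = solve-∀
            lay-out : N′ + (w + K * suc r) ≡ suc N′ + w + t * suc r + j + (u * suc r + suc v)
            lay-out = begin
              N′ + (w + K * suc r)                             ≡⟨ cong (λ k → N′ + (w + k * suc r)) t+1+u≡K ⟨
              N′ + (w + (suc t + u) * suc r)                   ≡⟨ ring₁ N′ w t u r ⟩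
              N′ + w + t * suc r + suc r + u * suc r           ≡⟨ cong (λ m → N′ + w + t * suc r + suc m + u * suc r) j+1+v≡r ⟨
              N′ + w + t * suc r + suc (suc j + v) + u * suc r ≡⟨ ring₂ N′ w (t * suc r) j v (u * suc r) ⟩
              suc N′ + w + t * suc r + j + (u * suc r + suc v) ∎

    extended-letters : letters (segment extended 0 (suc N)) ≤ letters (segment core 0 (suc N′)) + extensionLetters r δ
    extended-letters = begin
      letters (segment extended 0 (suc N))
        ≡⟨ cong (λ n → letters (segment extended 0 (suc n))) N′+δ≡N ⟨
      letters (segment extended 0 (suc N′ + (w + K * suc r)))
        ≡⟨ letters-segment-++ extended 0 (suc N′) (w + K * suc r) ⟩
      letters (segment extended 0 (suc N′)) + letters (segment extended (suc N′) (w + K * suc r))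
        ≡⟨ cong₂ _+_ (cong letters on-core) (letters-segment-++ extended (suc N′) w (K * suc r)) ⟩
      letters (segment core 0 (suc N′)) + (letters (segment extended (suc N′) w) + letters (segment extended (suc N′ + w) (K * suc r)))
        ≤⟨ +-monoʳ-≤ (letters (segment core 0 (suc N′))) (+-mono-≤ extended-letters-head extended-letters-tail) ⟩
      letters (segment core 0 (suc N′)) + (w ⊓ 1 + K)
        ≡⟨ cong (letters (segment core 0 (suc N′)) +_) (+-comm (w ⊓ 1) K) ⟩
      letters (segment core 0 (suc N′)) + extensionLetters r δ ∎
      where
        open ≤-Reasoning
        on-core : segment extended 0 (suc N′) ≡ segment core 0 (suc N′)
        on-core = segment-cong extended core 0 (suc N′) λ j j≤N′ → extended-core (≤-pred j≤N′)

extend-core : ∀ r N′ N (core : ℕ → Maybe A4) L →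
  (∀ i → i ≤ r → LetterOtherThan core i C) → r ≤ N′ → N′ ≤ N → Covers core N′ → letters (segment core 0 (suc N′)) ≤ L →
  HB4-atLeast (suc N) (suc N ∸ (L + extensionLetters r (N ∸ N′)))
extend-core r N′ N core L initial r≤N′ N′≤N core-covers few =
  covering-HB4 extended N _ (extended-covers initial r≤N′ N′≤N core-covers)
    (≤-trans (extended-letters N′≤N) (+-monoˡ-≤ (extensionLetters r (N ∸ N′)) few))
  where open Extension r N′ N core

initialBlock : ℕ → Maybe A4
initialBlock zero = just B
initialBlock (suc _) = just A

initialBlock-covers : ∀ r → Covers initialBlock r
initialBlock-covers r (suc d) _ d≤r = mismatch 0 refl d≤r (B , refl , λ ()) refl

initialBlock-letter : ∀ i {e} → e ≢ A → e ≢ B → LetterOtherThan initialBlock i e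
initialBlock-letter zero e≢A e≢B = B , refl , ≢-sym e≢B
initialBlock-letter (suc i) e≢A e≢B = A , refl , ≢-sym e≢A

-- The Wichmann ruler

module Wichmann (r s : ℕ) where

  Q R q P M E N′ : ℕ
  Q = suc (r + r)
  R = suc Q
  q = Q + R
  P = suc r * Q
  M = P + s * q
  E = M + suc r * R
  N′ = E + r

  ruler-from-M : ℕ → Maybe A4
  ruler-from-M p = if does (p ≤? E) then periodic R D (p ∸ M) else just A

  ruler-from-P : ℕ → Maybe A4
  ruler-from-P p = if does (p ≤? M) then (if does (p ≟ P) then just A else periodic q C (p ∸ P)) else ruler-from-M p

  -- Marks B at 0, A at 1 … r, B at k Q (1 ≤ k ≤ r), A at P, C at P + j q (1 ≤ j ≤ s),
  -- D at M + k R (1 ≤ k ≤ r + 1) and A at E + 1 … E + r: the gaps are 1^r, r + 1, (2r + 1)^r,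
  -- (4r + 3)^s, (2r + 2)^(r + 1), 1^r as in Wichmann's ruler.
  ruler : ℕ → Maybe A4
  ruler p = if does (p ≤? r) then initialBlock p else if does (p <? P) then periodic Q B p else ruler-from-P p

  r<Q : r < Q
  r<Q = s≤s (m≤m+n r r)

  r<P : r < P
  r<P = <-≤-trans r<Q (m≤m+n Q (r * Q))

  P≤M : P ≤ M
  P≤M = m≤m+n P (s * q)

  M≤E : M ≤ E
  M≤E = m≤m+n M (suc r * R)

  M≤N′ : M ≤ N′
  M≤N′ = ≤-trans M≤E (m≤m+n E r)

  P≤N′ : P ≤ N′
  P≤N′ = ≤-trans P≤M M≤N′

  ruler-≤r : ∀ {i} → i ≤ r → ruler i ≡ initialBlock i
  ruler-≤r {i} = if-yes (i ≤? r)

  ruler->r : ∀ {p} → r < p → ruler p ≡ (if does (p <? P) then periodic Q B p else ruler-from-P p)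
  ruler->r {p} r<p = if-no (p ≤? r) (<⇒≱ r<p)

  ruler-≥P : ∀ {p} → P ≤ p → ruler p ≡ ruler-from-P p
  ruler-≥P {p} P≤p = trans (ruler->r (<-≤-trans r<P P≤p)) (if-no (p <? P) (≤⇒≯ P≤p))

  ruler->M : ∀ {p} → M < p → ruler p ≡ ruler-from-M p
  ruler->M {p} M<p = trans (ruler-≥P (≤-trans P≤M (<⇒≤ M<p))) (if-no (p ≤? M) (<⇒≱ M<p))

  ruler-B-mark : ∀ k → k ≤ r → ruler (k * Q) ≡ just B
  ruler-B-mark zero _ = ruler-≤r z≤n
  ruler-B-mark (suc k) k<r = trans (ruler->r (<-≤-trans r<Q (m≤m+n Q (k * Q))))
    (trans (if-yes (suc k * Q <? P) (*-monoˡ-< Q (s≤s k<r))) (periodic-mark Q B (suc k)))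

  ruler-P : ruler P ≡ just A
  ruler-P = trans (ruler-≥P ≤-refl) (trans (if-yes (P ≤? M) P≤M) (if-yes (P ≟ P) refl))

  ruler-C-mark : ∀ j → j < s → ruler (P + suc j * q) ≡ just C
  ruler-C-mark j j<s = trans (ruler-≥P (m≤m+n P _))
    (trans (if-yes (_ ≤? M) (+-monoʳ-≤ P (*-monoˡ-≤ q j<s)))
    (trans (if-no (_ ≟ P) (>⇒≢ (m<m+n P z<s)))
    (trans (cong (periodic q C) (m+n∸m≡n P _)) (periodic-mark q C (suc j)))))

  D-mark≤N′ : ∀ k → k ≤ r → M + suc k * R ≤ N′
  D-mark≤N′ k k≤r = ≤-trans (+-monoʳ-≤ M (*-monoˡ-≤ R (s≤s k≤r))) (m≤m+n E r)

  ruler-D-mark : ∀ k → k ≤ r → ruler (M + suc k * R) ≡ just D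
  ruler-D-mark k k≤r = trans (ruler->M (m<m+n M z<s))
    (trans (if-yes (_ ≤? E) (+-monoʳ-≤ M (*-monoˡ-≤ R (s≤s k≤r))))
    (trans (cong (periodic R D) (m+n∸m≡n M _)) (periodic-mark R D (suc k))))

  ruler-final : ∀ i → ruler (E + suc i) ≡ just A
  ruler-final i = trans (ruler->M (≤-<-trans M≤E (m<m+n E z<s))) (if-no (_ ≤? E) (<⇒≱ (m<m+n E z<s)))

  ruler-initial : ∀ i → i ≤ r → ∀ {e} → e ≢ A → e ≢ B → LetterOtherThan ruler i e
  ruler-initial i i≤r e≢A e≢B with initialBlock-letter i e≢A e≢B
  ... | c , initial , c≢e = c , trans (ruler-≤r i≤r) initial , c≢e

  ruler-Q-multiple : ∀ k → k ≤ suc r → ∀ {e} → e ≢ A → e ≢ B → LetterOtherThan ruler (k * Q) e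
  ruler-Q-multiple k k≤1+r e≢A e≢B with m≤n⇒m<n∨m≡n k≤1+r
  ... | inj₁ k≤r = B , ruler-B-mark k (≤-pred k≤r) , ≢-sym e≢B
  ... | inj₂ refl = A , ruler-P , ≢-sym e≢A

  ruler-P-row : ∀ j → j ≤ s → LetterOtherThan ruler (P + j * q) D
  ruler-P-row zero _ = A , trans (cong ruler (+-identityʳ P)) ruler-P , λ ()
  ruler-P-row (suc j) j<s = C , ruler-C-mark j j<s , λ ()

  ruler-Q-gap : ∀ u v → 1 ≤ v → v < Q → r < u * Q + v → u * Q + v < P → ruler (u * Q + v) ≡ nothing
  ruler-Q-gap u v 1≤v v<Q r<p p<P =
    trans (ruler->r r<p) (trans (if-yes (_ <? P) p<P) (periodic-gap Q B u 1≤v v<Q))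

  ruler-C-gap : ∀ u v → 1 ≤ v → v < q → P + u * q + v ≤ M → ruler (P + u * q + v) ≡ nothing
  ruler-C-gap u v 1≤v v<q p≤M = trans (ruler-≥P (<⇒≤ P<p))
    (trans (if-yes (_ ≤? M) p≤M) (trans (if-no (_ ≟ P) (>⇒≢ P<p))
    (trans (cong (periodic q C) (trans (cong (_∸ P) (+-assoc P (u * q) v)) (m+n∸m≡n P _))) (periodic-gap q C u 1≤v v<q))))
    where
      P<p : P < P + u * q + v
      P<p = <-≤-trans (m<m+n P 1≤v) (+-monoˡ-≤ v (m≤m+n P (u * q)))

  ruler-D-gap : ∀ u v → 1 ≤ v → v < R → M + u * R + v ≤ E → ruler (M + u * R + v) ≡ nothing
  ruler-D-gap u v 1≤v v<R p≤E = trans (ruler->M M<p)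
    (trans (if-yes (_ ≤? E) p≤E)
    (trans (cong (periodic R D) (trans (cong (_∸ M) (+-assoc M (u * R) v)) (m+n∸m≡n M _))) (periodic-gap R D u 1≤v v<R)))
    where
      M<p : M < M + u * R + v
      M<p = <-≤-trans (m<m+n M 1≤v) (+-monoˡ-≤ v (m≤m+n M (u * R)))

  private
    block-position< : ∀ a m {t j K} → t < K → j < m → a + t * m + j < a + K * m
    block-position< a m {t} {j} {K} t<K j<m = begin-strict
      a + t * m + j   <⟨ +-monoʳ-< (a + t * m) j<m ⟩
      a + t * m + m   ≡⟨ +-assoc a (t * m) m ⟩
      a + (t * m + m) ≡⟨ cong (a +_) (+-comm (t * m) m) ⟩
      a + suc t * m   ≤⟨ +-monoʳ-≤ a (*-monoˡ-≤ m t<K) ⟩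
      a + K * m       ∎
      where open ≤-Reasoning

  ruler-letters : letters (segment ruler 0 (suc N′)) ≤ 4 * r + 3 + s
  ruler-letters = begin
    letters (segment ruler 0 (suc N′))
      ≡⟨ cong (λ n → letters (segment ruler 0 n)) (layout r s R q) ⟩
    letters (segment ruler 0 (suc r + (r + (r * Q + (s * q + (suc r * R + suc r))))))
      ≡⟨ split 0 (suc r) ⟩
    letters (segment ruler 0 (suc r)) + letters (segment ruler (suc r) (r + (r * Q + (s * q + (suc r * R + suc r)))))
      ≡⟨ cong (letters (segment ruler 0 (suc r)) +_) (split (suc r) r) ⟩
    letters (segment ruler 0 (suc r)) + (letters (segment ruler (suc r) r) + letters (segment ruler Q (r * Q + (s * q + (suc r * R + suc r)))))
      ≡⟨ cong (λ z → letters (segment ruler 0 (suc r)) + (letters (segment ruler (suc r) r) + z))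
           (trans (split Q (r * Q)) (cong (letters (segment ruler Q (r * Q)) +_)
           (trans (split P (s * q)) (cong (letters (segment ruler P (s * q)) +_) (split M (suc r * R)))))) ⟩
    letters (segment ruler 0 (suc r)) + (letters (segment ruler (suc r) r) + (letters (segment ruler Q (r * Q)) +
      (letters (segment ruler P (s * q)) + (letters (segment ruler M (suc r * R)) + letters (segment ruler E (suc r))))))
      ≤⟨ +-mono-≤ (letters-segment-≤ ruler 0 (suc r)) (+-mono-≤ (≤-reflexive gap-letters)
           (+-mono-≤ Q-letters (+-mono-≤ C-letters (+-mono-≤ D-letters (letters-segment-≤ ruler E (suc r)))))) ⟩
    suc r + (0 + (r + (s + (suc r + suc r))))
      ≡⟨ count r s ⟩
    4 * r + 3 + s ∎
    where
      open ≤-Reasoning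
      split : ∀ a k {l} → letters (segment ruler a (k + l)) ≡ letters (segment ruler a k) + letters (segment ruler (a + k) l)
      split a k {l} = letters-segment-++ ruler a k l
      layout : ∀ r s R q → suc (suc r * suc (r + r) + s * q + suc r * R + r) ≡
               suc r + (r + (r * suc (r + r) + (s * q + (suc r * R + suc r))))
      layout = solve-∀
      count : ∀ r s → suc r + (0 + (r + (s + (suc r + suc r)))) ≡ 4 * r + 3 + s
      count = solve-∀
      gap-letters : letters (segment ruler (suc r) r) ≡ 0
      gap-letters = letters-segment-holes ruler (suc r) r λ j j<r →
        let p<Q = +-monoʳ-< (suc r) j<r in
        ruler-Q-gap 0 (suc r + j) (s≤s z≤n) p<Q (s≤s (m≤m+n r j)) (<-≤-trans p<Q (m≤m+n Q (r * Q)))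
      Q-letters : letters (segment ruler Q (r * Q)) ≤ r
      Q-letters = letters-segment-blocks ruler Q Q 0 r λ t t<r j j<Q j≢0 →
        ruler-Q-gap (suc t) j (n≢0⇒n>0 j≢0) j<Q (<-≤-trans r<Q (≤-trans (m≤m+n Q (t * Q)) (m≤m+n _ j)))
          (block-position< Q Q t<r j<Q)
      C-letters : letters (segment ruler P (s * q)) ≤ s
      C-letters = letters-segment-blocks ruler P q 0 s λ t t<s j j<q j≢0 →
        ruler-C-gap t j (n≢0⇒n>0 j≢0) j<q (<⇒≤ (block-position< P q t<s j<q))
      D-letters : letters (segment ruler M (suc r * R)) ≤ suc r
      D-letters = letters-segment-blocks ruler M R 0 (suc r) λ t t<1+r j j<R j≢0 →
        ruler-D-gap t j (n≢0⇒n>0 j≢0) j<R (<⇒≤ (block-position< M R t<1+r j<R))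

  shift-Q-multiple : ∀ t → 1 ≤ t → t ≤ r → Mismatch ruler N′ (t * Q)
  shift-Q-multiple t 1≤t t≤r with m≤n⇒∃[o]m+o≡n t≤r
  ... | k , t+k≡r = mismatch (suc k * Q) reaches-P P≤N′ (B , ruler-B-mark (suc k) k<r , λ ()) ruler-P
    where
      k<r : k < r
      k<r = ≤-trans (+-monoˡ-≤ k 1≤t) (≤-reflexive t+k≡r)
      reaches-P : suc k * Q + t * Q ≡ P
      reaches-P = trans (sym (*-distribʳ-+ Q (suc k) t)) (cong (λ n → suc n * Q) (trans (+-comm k t) t+k≡r))

  shift-Q-to-C : ∀ X Y → suc Y ≤ X → X ≤ suc Y + r → Y < s → Mismatch ruler N′ (X * Q + suc Y * R)
  shift-Q-to-C X Y Y<X X≤Y+r Y<s with m≤n⇒∃[o]m+o≡n Y<X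
  ... | t , Y+1+t≡X with m≤n⇒∃[o]m+o≡n (+-cancelˡ-≤ (suc Y) t r (subst (_≤ suc Y + r) (sym Y+1+t≡X) X≤Y+r))
  ... | k , t+k≡r = mismatch (suc k * Q) reaches-C C-mark≤N′
    (ruler-Q-multiple (suc k) (s≤s (≤-trans (m≤n+m k t) (≤-reflexive t+k≡r))) (λ ()) (λ ())) (ruler-C-mark Y Y<s)
    where
      open ≡-Reasoning
      ring : ∀ k Y t Q R → suc k * Q + ((Y + t) * Q + Y * R) ≡ suc (t + k) * Q + Y * (Q + R)
      ring = solve-∀
      reaches-C : suc k * Q + (X * Q + suc Y * R) ≡ P + suc Y * q
      reaches-C = begin
        suc k * Q + (X * Q + suc Y * R)             ≡⟨ cong (λ x → suc k * Q + (x * Q + suc Y * R)) Y+1+t≡X ⟨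
        suc k * Q + ((suc Y + t) * Q + suc Y * R)   ≡⟨ ring k (suc Y) t Q R ⟩
        suc (t + k) * Q + suc Y * q                 ≡⟨ cong (λ n → suc n * Q + suc Y * q) t+k≡r ⟩
        P + suc Y * q                               ∎
      C-mark≤N′ : P + suc Y * q ≤ N′
      C-mark≤N′ = ≤-trans (+-monoʳ-≤ P (*-monoˡ-≤ q Y<s)) M≤N′

  shift-Q-to-D : ∀ X Y → s ≤ X → X ≤ s + r → s ≤ Y → Y ≤ s + r → Mismatch ruler N′ (X * Q + suc Y * R)
  shift-Q-to-D X Y s≤X X≤s+r s≤Y Y≤s+r with m≤n⇒∃[o]m+o≡n s≤X | m≤n⇒∃[o]m+o≡n s≤Y
  ... | t , s+t≡X | k , s+k≡Y with m≤n⇒∃[o]m+o≡n (+-cancelˡ-≤ s t r (subst (_≤ s + r) (sym s+t≡X) X≤s+r))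
  ... | m , t+m≡r = mismatch (suc m * Q) reaches-D (D-mark≤N′ k k≤r)
    (ruler-Q-multiple (suc m) (s≤s (≤-trans (m≤n+m m t) (≤-reflexive t+m≡r))) (λ ()) (λ ())) (ruler-D-mark k k≤r)
    where
      open ≡-Reasoning
      k≤r : k ≤ r
      k≤r = +-cancelˡ-≤ s k r (subst (_≤ s + r) (sym s+k≡Y) Y≤s+r)
      ring : ∀ m s t k Q R → suc m * Q + ((s + t) * Q + suc (s + k) * R) ≡ suc (t + m) * Q + s * (Q + R) + suc k * R
      ring = solve-∀
      reaches-D : suc m * Q + (X * Q + suc Y * R) ≡ M + suc k * R
      reaches-D = begin
        suc m * Q + (X * Q + suc Y * R)                   ≡⟨ cong₂ (λ x y → suc m * Q + (x * Q + suc y * R)) s+t≡X s+k≡Y ⟨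
        suc m * Q + ((s + t) * Q + suc (s + k) * R)       ≡⟨ ring m s t k Q R ⟩
        suc (t + m) * Q + s * q + suc k * R               ≡⟨ cong (λ n → suc n * Q + s * q + suc k * R) t+m≡r ⟩
        M + suc k * R                                     ∎

  shift-C-to-D : ∀ X Y → X ≤ Y → suc Y ≤ X + suc r → X ≤ s → Mismatch ruler N′ (X * Q + suc Y * R)
  shift-C-to-D X Y X≤Y Y<X+r X≤s with m≤n⇒∃[o]m+o≡n X≤Y | m≤n⇒∃[o]m+o≡n X≤s
  ... | k , X+k≡Y | u , X+u≡s = mismatch (P + u * q) reaches-D (D-mark≤N′ k k≤r)
    (ruler-P-row u (≤-trans (m≤n+m u X) (≤-reflexive X+u≡s))) (ruler-D-mark k k≤r)
    where
      open ≡-Reasoning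
      k≤r : k ≤ r
      k≤r = ≤-pred (+-cancelˡ-≤ X (suc k) (suc r) (subst (_≤ X + suc r) (trans (cong suc (sym X+k≡Y)) (sym (+-suc X k))) Y<X+r))
      ring : ∀ P u X k Q R → P + u * (Q + R) + (X * Q + suc (X + k) * R) ≡ P + (X + u) * (Q + R) + suc k * R
      ring = solve-∀
      reaches-D : P + u * q + (X * Q + suc Y * R) ≡ M + suc k * R
      reaches-D = begin
        P + u * q + (X * Q + suc Y * R)             ≡⟨ cong (λ y → P + u * q + (X * Q + suc y * R)) X+k≡Y ⟨
        P + u * q + (X * Q + suc (X + k) * R)       ≡⟨ ring P u X k Q R ⟩
        P + (X + u) * q + suc k * R                 ≡⟨ cong (λ n → P + n * q + suc k * R) X+u≡s ⟩
        M + suc k * R                               ∎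

  -- The heart of Wichmann's construction: these combinations of the gap lengths Q and R are
  -- differences of two marks, and the colouring makes the two letters distinct.
  lattice-mismatch : ∀ X Y → 1 ≤ X + Y → X ≤ Y + r → Y ≤ X + suc r → X ≤ s + r → Y ≤ s + suc r →
                     Mismatch ruler N′ (X * Q + Y * R)
  lattice-mismatch X zero 1≤X X≤r _ _ _ =
    subst (Mismatch ruler N′) (sym (+-identityʳ (X * Q))) (shift-Q-multiple X (subst (1 ≤_) (+-identityʳ X) 1≤X) X≤r)
  lattice-mismatch X (suc Y) _ X≤Y+r Y<X+r X≤s+r Y<s+r with s ≤? X | s ≤? Y | suc Y ≤? X
  ... | yes s≤X | yes s≤Y | _ = shift-Q-to-D X Y s≤X X≤s+r s≤Y (≤-pred (subst (suc Y ≤_) (+-suc s r) Y<s+r))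
  ... | yes s≤X | no s≰Y | yes Y<X = shift-Q-to-C X Y Y<X X≤Y+r (≰⇒> s≰Y)
  ... | yes s≤X | no s≰Y | no Y≮X = shift-C-to-D X Y (≤-pred (≰⇒> Y≮X)) Y<X+r (≤-trans (≤-pred (≰⇒> Y≮X)) (<⇒≤ (≰⇒> s≰Y)))
  ... | no s≰X | _ | yes Y<X = shift-Q-to-C X Y Y<X X≤Y+r (≤-trans Y<X (<⇒≤ (≰⇒> s≰X)))
  ... | no s≰X | _ | no Y≮X = shift-C-to-D X Y (≤-pred (≰⇒> Y≮X)) Y<X+r (<⇒≤ (≰⇒> s≰X))

  shift-D-to-final : ∀ t i → t ≤ r → i < r → Mismatch ruler N′ (suc (t + i) + t * Q)
  shift-D-to-final t i t≤r i<r with m≤n⇒∃[o]m+o≡n t≤r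
  ... | m , t+m≡r = mismatch (M + suc m * R) reaches-final (+-monoʳ-≤ E i<r)
    (D , ruler-D-mark m (≤-trans (m≤n+m m t) (≤-reflexive t+m≡r)) , λ ()) (ruler-final i)
    where
      ring : ∀ M m t i Q → M + suc m * suc Q + (suc (t + i) + t * Q) ≡ M + suc (t + m) * suc Q + suc i
      ring = solve-∀
      reaches-final : M + suc m * R + (suc (t + i) + t * Q) ≡ E + suc i
      reaches-final = trans (ring M m t i Q) (cong (λ n → M + suc n * R + suc i) t+m≡r)

  shift-initial-to-Q : ∀ w i t → Q ≡ w + suc i → i < r → t < r → Mismatch ruler N′ (w + t * Q)
  shift-initial-to-Q w i t Q≡w+1+i i<r t<r = mismatch (suc i) reaches-Q
    (≤-trans (*-monoˡ-≤ Q (m≤n⇒m≤1+n t<r)) P≤N′) (A , ruler-≤r i<r , λ ()) (ruler-B-mark (suc t) t<r)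
    where
      ring : ∀ i w t Q → suc i + (w + t * Q) ≡ (w + suc i) + t * Q
      ring = solve-∀
      reaches-Q : suc i + (w + t * Q) ≡ suc t * Q
      reaches-Q = trans (ring i w t Q) (cong (_+ t * Q) (sym Q≡w+1+i))

  bottom-decomposed : ∀ w t → w < Q → 1 ≤ w + t * Q → t ≤ r → Mismatch ruler N′ (w + t * Q)
  bottom-decomposed w t w<Q 1≤d t≤r with w ≤? t
  ... | yes w≤t with m≤n⇒∃[o]m+o≡n w≤t
  ... | X , w+X≡t = subst (Mismatch ruler N′) (sym as-lattice)
    (lattice-mismatch X w nonzero (m≤n⇒m≤o+n w X≤r) (m≤n⇒m≤o+n X (m≤n⇒m≤1+n w≤r)) (m≤n⇒m≤o+n s X≤r) (m≤n⇒m≤o+n s (m≤n⇒m≤1+n w≤r)))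
    where
      ring : ∀ w X Q → w + (w + X) * Q ≡ X * Q + w * suc Q
      ring = solve-∀
      as-lattice : w + t * Q ≡ X * Q + w * R
      as-lattice = trans (cong (λ n → w + n * Q) (sym w+X≡t)) (ring w X Q)
      X≤r : X ≤ r
      X≤r = ≤-trans (m≤n+m X w) (≤-trans (≤-reflexive w+X≡t) t≤r)
      w≤r : w ≤ r
      w≤r = ≤-trans w≤t t≤r
      nonzero : 1 ≤ X + w
      nonzero = n≢0⇒n>0 λ X+w≡0 → contradiction
        (subst₂ (λ a b → 1 ≤ a + b * Q) (m+n≡0⇒n≡0 X X+w≡0) (trans (sym w+X≡t) (trans (+-comm w X) X+w≡0)) 1≤d) λ ()
  bottom-decomposed w t w<Q 1≤d t≤r | no w≰t with m≤n⇒∃[o]m+o≡n (≰⇒> w≰t)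
  ... | i , t+1+i≡w with i <? r
  ... | yes i<r = subst (λ x → Mismatch ruler N′ (x + t * Q)) t+1+i≡w (shift-D-to-final t i t≤r i<r)
  ... | no i≮r with m≤n⇒∃[o]m+o≡n w<Q
  ... | j , w+1+j≡Q = shift-initial-to-Q w j t (trans (sym w+1+j≡Q) (sym (+-suc w j))) j<r t<r
    where
      open ≤-Reasoning
      w+j≡r+r : w + j ≡ r + r
      w+j≡r+r = suc-injective w+1+j≡Q
      r<w : r < w
      r<w = ≤-trans (s≤s (≤-trans (≮⇒≥ i≮r) (m≤n+m i t))) (≤-reflexive t+1+i≡w)
      j<r : j < r
      j<r = +-cancelˡ-≤ r (suc j) r (begin
        r + suc j ≡⟨ +-suc r j ⟩
        suc r + j ≤⟨ +-monoˡ-≤ j r<w ⟩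
        w + j     ≡⟨ w+j≡r+r ⟩
        r + r     ∎)
      t<r : t < r
      t<r = +-cancelˡ-≤ r (suc t) r (begin
        r + suc t ≡⟨ +-comm r (suc t) ⟩
        suc t + r ≤⟨ +-monoʳ-≤ (suc t) (≮⇒≥ i≮r) ⟩
        suc t + i ≡⟨ t+1+i≡w ⟩
        w         ≤⟨ m≤m+n w j ⟩
        w + j     ≡⟨ w+j≡r+r ⟩
        r + r     ∎)

  bottom-mismatch : ∀ d → 1 ≤ d → d < P → Mismatch ruler N′ d
  bottom-mismatch d 1≤d d<P = subst (Mismatch ruler N′) (sym d≡)
    (bottom-decomposed (d % Q) (d / Q) (m%n<n d Q) (subst (1 ≤_) d≡ 1≤d)
      (≤-pred (*-cancelʳ-< Q (d / Q) (suc r) (≤-<-trans (m/n*n≤m d Q) d<P))))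
    where
      d≡ : d ≡ d % Q + d / Q * Q
      d≡ = m≡m%n+[m/n]*n d Q

  middle-lattice-low : ∀ D′ c α → D′ + Q ≡ c + α * q → α ≤ s → c ≤ r → Mismatch ruler N′ (P + D′)
  middle-lattice-low D′ c zero D′+Q≡ _ c≤r =
    contradiction (subst (Q ≤_) (trans D′+Q≡ (+-identityʳ c)) (m≤n+m Q D′)) (<⇒≱ (≤-<-trans c≤r r<Q))
  middle-lattice-low D′ c (suc α) D′+Q≡ α<s c≤r with m≤n⇒∃[o]m+o≡n c≤r
  ... | v , c+v≡r = subst (Mismatch ruler N′) (sym as-lattice)
    (lattice-mismatch (suc α + v) (suc α + c) (s≤s z≤n) (+-mono-≤ (m≤m+n (suc α) c) v≤r)
      (+-mono-≤ (m≤m+n (suc α) v) (m≤n⇒m≤1+n c≤r)) (+-mono-≤ α<s v≤r) (+-mono-≤ α<s (m≤n⇒m≤1+n c≤r)))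
    where
      open ≡-Reasoning
      v≤r : v ≤ r
      v≤r = ≤-trans (m≤n+m v c) (≤-reflexive c+v≡r)
      ring : ∀ α v c Q → (α + v) * Q + (α + c) * suc Q + Q ≡ suc (c + v) * Q + (c + α * (Q + suc Q))
      ring = solve-∀
      as-lattice : P + D′ ≡ (suc α + v) * Q + (suc α + c) * R
      as-lattice = +-cancelʳ-≡ Q _ _ (begin
        P + D′ + Q                            ≡⟨ +-assoc P D′ Q ⟩
        P + (D′ + Q)                          ≡⟨ cong (P +_) D′+Q≡ ⟩
        P + (c + suc α * q)                   ≡⟨ cong (λ n → suc n * Q + (c + suc α * q)) c+v≡r ⟨
        suc (c + v) * Q + (c + suc α * q)     ≡⟨ ring (suc α) v c Q ⟨
        (suc α + v) * Q + (suc α + c) * R + Q ∎)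

  complement-reaches-P-row : ∀ D′ c α i → D′ + Q ≡ c + α * q → c + i ≡ Q → i + (P + D′) ≡ P + α * q
  complement-reaches-P-row D′ c α i D′+Q≡ c+i≡Q = +-cancelʳ-≡ c _ _ (begin
    i + (P + D′) + c        ≡⟨ ring₁ i P D′ c ⟩
    P + (D′ + (c + i))      ≡⟨ cong (λ x → P + (D′ + x)) c+i≡Q ⟩
    P + (D′ + Q)            ≡⟨ cong (P +_) D′+Q≡ ⟩
    P + (c + α * q)         ≡⟨ ring₂ P c (α * q) ⟩
    P + α * q + c           ∎)
    where
      open ≡-Reasoning
      ring₁ : ∀ i P D′ c → i + (P + D′) + c ≡ P + (D′ + (c + i))
      ring₁ = solve-∀
      ring₂ : ∀ P c x → P + (c + x) ≡ P + x + c
      ring₂ = solve-∀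

  middle-initial-to-P-row : ∀ D′ c α → D′ + Q ≡ c + α * q → α ≤ s → r < c → c ≤ Q → Mismatch ruler N′ (P + D′)
  middle-initial-to-P-row D′ c zero D′+Q≡ _ _ c≤Q with m≤n⇒∃[o]m+o≡n c≤Q
  ... | i , c+i≡Q = mismatch i reaches-P (≤-trans (≤-reflexive (+-identityʳ P)) P≤N′)
    (B , subst (λ j → ruler j ≡ just B) (sym i≡0) (ruler-B-mark 0 z≤n) , λ ()) (trans (cong ruler (+-identityʳ P)) ruler-P)
    where
      reaches-P : i + (P + D′) ≡ P + 0 * q
      reaches-P = complement-reaches-P-row D′ c 0 i D′+Q≡ c+i≡Q
      i≡0 : i ≡ 0
      i≡0 = m+n≡0⇒m≡0 i (+-cancelˡ-≡ P (i + D′) 0 (trans (sym (x∙yz≈y∙xz i P D′)) reaches-P))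
  middle-initial-to-P-row D′ c (suc α) D′+Q≡ α<s r<c c≤Q with m≤n⇒∃[o]m+o≡n c≤Q
  ... | i , c+i≡Q = mismatch i (complement-reaches-P-row D′ c (suc α) i D′+Q≡ c+i≡Q)
    (≤-trans (+-monoʳ-≤ P (*-monoˡ-≤ q α<s)) M≤N′)
    (ruler-initial i (+-cancelˡ-≤ (suc r) i r (≤-trans (+-monoˡ-≤ i r<c) (≤-reflexive c+i≡Q))) (λ ()) (λ ()))
    (ruler-C-mark α α<s)

  middle-lattice-high : ∀ D′ c α → D′ + Q ≡ c + α * q → α ≤ s → Q < c → c ≤ Q + suc r → Mismatch ruler N′ (P + D′)
  middle-lattice-high D′ c α D′+Q≡ α≤s Q<c c≤Q+1+r with m≤n⇒∃[o]m+o≡n Q<c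
  ... | v , Q+1+v≡c with m≤n⇒∃[o]m+o≡n (≤-pred (+-cancelˡ-≤ Q (suc v) (suc r)
                           (≤-trans (≤-reflexive (trans (+-suc Q v) Q+1+v≡c)) c≤Q+1+r)))
  ... | z , v+z≡r = subst (Mismatch ruler N′) (sym as-lattice)
    (lattice-mismatch (α + z) (α + suc v) nonzero (+-mono-≤ (m≤m+n α (suc v)) z≤r) (+-mono-≤ (m≤m+n α z) (s≤s v≤r))
      (+-mono-≤ α≤s z≤r) (+-mono-≤ α≤s (s≤s v≤r)))
    where
      open ≡-Reasoning
      v≤r : v ≤ r
      v≤r = ≤-trans (m≤m+n v z) (≤-reflexive v+z≡r)
      z≤r : z ≤ r
      z≤r = ≤-trans (m≤n+m z v) (≤-reflexive v+z≡r)
      nonzero : 1 ≤ (α + z) + (α + suc v)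
      nonzero = ≤-trans (s≤s z≤n) (≤-trans (≤-reflexive (sym (+-suc α v))) (m≤n+m (α + suc v) (α + z)))
      ring : ∀ α z v Q → (α + z) * Q + (α + suc v) * suc Q + Q ≡ suc (v + z) * Q + (suc Q + v + α * (Q + suc Q))
      ring = solve-∀
      as-lattice : P + D′ ≡ (α + z) * Q + (α + suc v) * R
      as-lattice = +-cancelʳ-≡ Q _ _ (begin
        P + D′ + Q                               ≡⟨ +-assoc P D′ Q ⟩
        P + (D′ + Q)                             ≡⟨ cong (P +_) D′+Q≡ ⟩
        P + (c + α * q)                          ≡⟨ cong (λ x → P + (x + α * q)) Q+1+v≡c ⟨
        P + (suc Q + v + α * q)                  ≡⟨ cong (λ n → suc n * Q + (suc Q + v + α * q)) v+z≡r ⟨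
        suc (v + z) * Q + (suc Q + v + α * q)    ≡⟨ ring α z v Q ⟨
        (α + z) * Q + (α + suc v) * R + Q        ∎)

  middle-C-to-final : ∀ D′ c α → D′ + Q ≡ c + α * q → α < s → c < q → Q + suc r < c → Mismatch ruler N′ (P + D′)
  middle-C-to-final D′ c α D′+Q≡ α<s c<q Q+1+r<c with m≤n⇒∃[o]m+o≡n α<s | m≤n⇒∃[o]m+o≡n Q+1+r<c
  ... | u , α+1+u≡s | i , Q+r+2+i≡c = mismatch (P + suc u * q) reaches-final (+-monoʳ-≤ E i<r)
    (C , ruler-C-mark u (≤-trans (s≤s (m≤n+m u α)) (≤-reflexive α+1+u≡s)) , λ ()) (ruler-final i)
    where
      ring₁ : ∀ Q r i → Q + suc r + suc (suc i) ≡ suc (suc (Q + suc r) + i)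
      ring₁ = solve-∀
      ring₂ : ∀ Q r → Q + suc (suc (r + r)) ≡ Q + suc r + suc r
      ring₂ = solve-∀
      i<r : i < r
      i<r = ≤-pred (+-cancelˡ-≤ (Q + suc r) (suc (suc i)) (suc r) (begin
        Q + suc r + suc (suc i)   ≡⟨ ring₁ Q r i ⟩
        suc (suc (Q + suc r) + i) ≡⟨ cong suc Q+r+2+i≡c ⟩
        suc c                     ≤⟨ c<q ⟩
        q                         ≡⟨ ring₂ Q r ⟩
        Q + suc r + suc r         ∎))
        where open ≤-Reasoning
      ring₃ : ∀ r Q u α i q → suc r * Q + suc u * q + (suc r * Q + (suc (Q + suc r) + i + α * q)) ≡
                               suc r * Q + (suc α + u) * q + suc r * suc Q + suc i + Q
      ring₃ = solve-∀
      reaches-final : P + suc u * q + (P + D′) ≡ E + suc i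
      reaches-final = +-cancelʳ-≡ Q _ _ (begin
        P + suc u * q + (P + D′) + Q                        ≡⟨ +-assoc (P + suc u * q) (P + D′) Q ⟩
        P + suc u * q + (P + D′ + Q)                        ≡⟨ cong (λ x → P + suc u * q + x) (+-assoc P D′ Q) ⟩
        P + suc u * q + (P + (D′ + Q))                      ≡⟨ cong (λ x → P + suc u * q + (P + x)) D′+Q≡ ⟩
        P + suc u * q + (P + (c + α * q))                   ≡⟨ cong (λ x → P + suc u * q + (P + (x + α * q))) Q+r+2+i≡c ⟨
        P + suc u * q + (P + (suc (Q + suc r) + i + α * q)) ≡⟨ ring₃ r Q u α i q ⟩
        P + (suc α + u) * q + suc r * R + suc i + Q         ≡⟨ cong (λ n → P + n * q + suc r * R + suc i + Q) α+1+u≡s ⟩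
        E + suc i + Q                                       ∎)
        where open ≡-Reasoning

  private
    row≤s : ∀ c α → c + α * q ≤ Q + s * q → α ≤ s
    row≤s c α bound = ≮⇒≥ λ s<α → <⇒≱ (begin-strict
      Q + s * q   <⟨ +-monoˡ-< (s * q) (m<m+n Q z<s) ⟩
      q + s * q   ≤⟨ *-monoˡ-≤ q s<α ⟩
      α * q       ≤⟨ m≤n+m (α * q) c ⟩
      c + α * q   ∎) bound
      where open ≤-Reasoning

    row<s : ∀ c α → Q < c → c + α * q ≤ Q + s * q → α < s
    row<s c α Q<c bound = ≰⇒> λ s≤α → <⇒≱ (begin-strict
      Q + s * q   <⟨ +-monoˡ-< (s * q) Q<c ⟩
      c + s * q   ≤⟨ +-monoʳ-≤ c (*-monoˡ-≤ q s≤α) ⟩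
      c + α * q   ∎) bound
      where open ≤-Reasoning

  -- A middle shift P + D′ is sorted by the residue c of D′ + Q modulo q = 4 r + 3.
  middle-by-residue : ∀ D′ c α → D′ + Q ≡ c + α * q → c < q → c + α * q ≤ Q + s * q → Mismatch ruler N′ (P + D′)
  middle-by-residue D′ c α D′+Q≡ c<q bound with c ≤? r | c ≤? Q | c ≤? Q + suc r
  ... | yes c≤r | _ | _ = middle-lattice-low D′ c α D′+Q≡ (row≤s c α bound) c≤r
  ... | no c≰r | yes c≤Q | _ = middle-initial-to-P-row D′ c α D′+Q≡ (row≤s c α bound) (≰⇒> c≰r) c≤Q
  ... | no _ | no c≰Q | yes c≤Q+1+r = middle-lattice-high D′ c α D′+Q≡ (row≤s c α bound) (≰⇒> c≰Q) c≤Q+1+r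
  ... | no _ | no c≰Q | no c≰Q+1+r = middle-C-to-final D′ c α D′+Q≡ (row<s c α (≰⇒> c≰Q) bound) c<q (≰⇒> c≰Q+1+r)

  middle-mismatch : ∀ D′ → D′ ≤ s * q → Mismatch ruler N′ (P + D′)
  middle-mismatch D′ D′≤sq = middle-by-residue D′ ((D′ + Q) % q) ((D′ + Q) / q) D′+Q≡ (m%n<n (D′ + Q) q)
    (subst (_≤ Q + s * q) D′+Q≡ (≤-trans (+-monoˡ-≤ Q D′≤sq) (≤-reflexive (+-comm (s * q) Q))))
    where
      D′+Q≡ : D′ + Q ≡ (D′ + Q) % q + (D′ + Q) / q * q
      D′+Q≡ = m≡m%n+[m/n]*n (D′ + Q) q

  top-Q-to-D : ∀ w t → 1 ≤ t + w → t + w ≤ suc r → Mismatch ruler N′ (M + (w + t * R))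
  top-Q-to-D w t 1≤t+w t+w≤1+r with m≤n⇒∃[o]m+o≡n 1≤t+w
  ... | k , 1+k≡t+w = mismatch (w * Q) reaches-D (D-mark≤N′ k k≤r)
    (ruler-Q-multiple w (≤-trans (m≤n+m w t) t+w≤1+r) (λ ()) (λ ())) (ruler-D-mark k k≤r)
    where
      k≤r : k ≤ r
      k≤r = ≤-pred (≤-trans (≤-reflexive 1+k≡t+w) t+w≤1+r)
      ring : ∀ w M t Q → w * Q + (M + (w + t * suc Q)) ≡ M + (t + w) * suc Q
      ring = solve-∀
      reaches-D : w * Q + (M + (w + t * R)) ≡ M + suc k * R
      reaches-D = trans (ring w M t Q) (cong (λ n → M + n * R) (sym 1+k≡t+w))

  top-B-to-final : ∀ m i t → m + t ≡ suc r → m ≤ r → i < r → Mismatch ruler N′ (M + (m + suc i + t * R))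
  top-B-to-final m i t m+t≡1+r m≤r i<r = mismatch (m * Q) reaches-final (+-monoʳ-≤ E i<r)
    (B , ruler-B-mark m m≤r , λ ()) (ruler-final i)
    where
      ring : ∀ m M i t Q → m * Q + (M + (m + suc i + t * suc Q)) ≡ M + (m + t) * suc Q + suc i
      ring = solve-∀
      reaches-final : m * Q + (M + (m + suc i + t * R)) ≡ E + suc i
      reaches-final = trans (ring m M i t Q) (cong (λ n → M + n * R + suc i) m+t≡1+r)

  top-initial-to-D : ∀ w i t → R ≡ w + suc i → i < r → t ≤ r → Mismatch ruler N′ (M + (w + t * R))
  top-initial-to-D w i t R≡w+1+i i<r t≤r = mismatch (suc i) reaches-D (D-mark≤N′ t t≤r)
    (A , ruler-≤r i<r , λ ()) (ruler-D-mark t t≤r)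
    where
      ring : ∀ i M w t R → suc i + (M + (w + t * R)) ≡ M + ((w + suc i) + t * R)
      ring = solve-∀
      reaches-D : suc i + (M + (w + t * R)) ≡ M + suc t * R
      reaches-D = trans (ring i M w t R) (cong (λ x → M + (x + t * R)) (sym R≡w+1+i))

  top-last-row : ∀ w t → r < t → w + t * R ≤ suc r * R + r → t ≡ suc r × w ≤ r
  top-last-row w t r<t D′≤ = t≡1+r , +-cancelʳ-≤ (suc r * R) w r (begin
    w + suc r * R ≡⟨ cong (λ n → w + n * R) t≡1+r ⟨
    w + t * R     ≤⟨ D′≤ ⟩
    suc r * R + r ≡⟨ +-comm (suc r * R) r ⟩
    r + suc r * R ∎)
    where
      open ≤-Reasoning
      t≡1+r : t ≡ suc r
      t≡1+r = ≤-antisym (≮⇒≥ λ 1+r<t → <⇒≱ (begin-strict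
        suc r * R + r <⟨ +-monoʳ-< (suc r * R) (<-trans r<Q (n<1+n Q)) ⟩
        suc r * R + R ≡⟨ +-comm (suc r * R) R ⟩
        suc (suc r) * R ≤⟨ *-monoˡ-≤ R 1+r<t ⟩
        t * R ≤⟨ m≤n+m (t * R) w ⟩
        w + t * R ∎) D′≤) r<t

  top-middle-row : ∀ w t → t ≤ r → suc r < t + w → w ≤ suc r → Mismatch ruler N′ (M + (w + t * R))
  top-middle-row w t t≤r 1+r<t+w w≤1+r = subst (λ x → Mismatch ruler N′ (M + (x + t * R))) w≡
    (top-B-to-final (suc k) i t (cong suc (trans (+-comm k t) t+k≡r)) (≤-trans (+-monoˡ-≤ k 1≤t) (≤-reflexive t+k≡r))
      (≤-trans (m≤n+m (suc i) k) (≤-pred (≤-trans (≤-reflexive w≡) w≤1+r))))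
    where
      open ≤-Reasoning
      k : ℕ
      k = r ∸ t
      t+k≡r : t + k ≡ r
      t+k≡r = m+[n∸m]≡n t≤r
      k+2≤w : suc (suc k) ≤ w
      k+2≤w = +-cancelˡ-≤ t (suc (suc k)) w (begin
        t + suc (suc k)   ≡⟨ +-suc t (suc k) ⟩
        suc (t + suc k)   ≡⟨ cong suc (+-suc t k) ⟩
        suc (suc (t + k)) ≡⟨ cong (λ n → suc (suc n)) t+k≡r ⟩
        suc (suc r)       ≤⟨ 1+r<t+w ⟩
        t + w             ∎)
      i : ℕ
      i = w ∸ suc (suc k)
      w≡ : suc k + suc i ≡ w
      w≡ = trans (+-suc (suc k) i) (m+[n∸m]≡n k+2≤w)
      1≤t : 1 ≤ t
      1≤t = n≢0⇒n>0 λ t≡0 → <⇒≱ 1+r<t+w (subst (λ x → x + w ≤ suc r) (sym t≡0) w≤1+r)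

  top-initial-row : ∀ w t → t ≤ r → w < R → suc r < w → Mismatch ruler N′ (M + (w + t * R))
  top-initial-row w t t≤r w<R 1+r<w = top-initial-to-D w i t R≡w+1+i i<r t≤r
    where
      open ≤-Reasoning
      i : ℕ
      i = R ∸ suc w
      R≡w+1+i : R ≡ w + suc i
      R≡w+1+i = sym (trans (+-suc w i) (m+[n∸m]≡n w<R))
      i<r : i < r
      i<r = +-cancelˡ-≤ r (suc i) r (≤-pred (≤-pred (begin
        suc (suc r) + suc i ≤⟨ +-monoˡ-≤ (suc i) 1+r<w ⟩
        w + suc i           ≡⟨ R≡w+1+i ⟨
        R                   ∎)))

  top-decomposed : ∀ w t → w < R → 1 ≤ w + t * R → w + t * R ≤ suc r * R + r → Mismatch ruler N′ (M + (w + t * R))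
  top-decomposed w t w<R 1≤D′ D′≤ with t ≤? r
  top-decomposed zero t w<R 1≤D′ D′≤ | no t≰r with top-last-row zero t (≰⇒> t≰r) D′≤
  ... | t≡1+r , _ = top-Q-to-D zero t (subst (λ n → 1 ≤ n + 0) (sym t≡1+r) (s≤s z≤n)) (≤-reflexive (trans (+-identityʳ t) t≡1+r))
  top-decomposed (suc i) t w<R 1≤D′ D′≤ | no t≰r with top-last-row (suc i) t (≰⇒> t≰r) D′≤
  ... | t≡1+r , i<r = top-B-to-final 0 i t t≡1+r z≤n i<r
  top-decomposed w t w<R 1≤D′ D′≤ | yes t≤r with t + w ≤? suc r | w ≤? suc r
  ... | yes t+w≤1+r | _ = top-Q-to-D w t nonzero t+w≤1+r
    where
      nonzero : 1 ≤ t + w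
      nonzero = n≢0⇒n>0 λ t+w≡0 → contradiction
        (subst₂ (λ a b → 1 ≤ a + b * R) (m+n≡0⇒n≡0 t t+w≡0) (m+n≡0⇒m≡0 t t+w≡0) 1≤D′) λ ()
  ... | no t+w≰1+r | yes w≤1+r = top-middle-row w t t≤r (≰⇒> t+w≰1+r) w≤1+r
  ... | no _ | no w≰1+r = top-initial-row w t t≤r w<R (≰⇒> w≰1+r)

  top-mismatch : ∀ D′ → 1 ≤ D′ → D′ ≤ suc r * R + r → Mismatch ruler N′ (M + D′)
  top-mismatch D′ 1≤D′ D′≤ = subst (λ x → Mismatch ruler N′ (M + x)) (sym D′≡)
    (top-decomposed (D′ % R) (D′ / R) (m%n<n D′ R) (subst (1 ≤_) D′≡ 1≤D′) (subst (_≤ suc r * R + r) D′≡ D′≤))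
    where
      D′≡ : D′ ≡ D′ % R + D′ / R * R
      D′≡ = m≡m%n+[m/n]*n D′ R

  ruler-covers : Covers ruler N′
  ruler-covers d 1≤d d≤N′ with d <? P | d ≤? M
  ... | yes d<P | _ = bottom-mismatch d 1≤d d<P
  ... | no d≮P | yes d≤M = subst (Mismatch ruler N′) (m+[n∸m]≡n (≮⇒≥ d≮P))
    (middle-mismatch (d ∸ P) (≤-trans (∸-monoˡ-≤ P d≤M) (≤-reflexive (m+n∸m≡n P (s * q)))))
  ... | no _ | no d≰M = subst (Mismatch ruler N′) (m+[n∸m]≡n (<⇒≤ (≰⇒> d≰M)))
    (top-mismatch (d ∸ M) (m<n⇒0<n∸m (≰⇒> d≰M))
      (≤-trans (∸-monoˡ-≤ M d≤N′) (≤-reflexive (trans (cong (_∸ M) (+-assoc M (suc r * R) r)) (m+n∸m≡n M _)))))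

-- The counting inequality

wichmannLength : ℕ → ℕ → ℕ
wichmannLength ρ s = 16 * (ρ * ρ) + 16 * ρ + 3 + s * (8 * ρ + 3)

gaps-upper : ∀ ρ s δ → 2 ≤ ρ → wichmannLength ρ s + δ < 48 * (suc ρ * suc ρ) → s ≤ 4 * ρ + 9
gaps-upper ρ s δ 2≤ρ hi with m≤n⇒∃[o]m+o≡n 2≤ρ
... | k , refl = ≮⇒≥ λ 4ρ+9<s → <⇒≱ hi (begin
  48 * ((3 + k) * (3 + k))                                    ≤⟨ m≤m+n _ (12 * k + 9) ⟩
  48 * ((3 + k) * (3 + k)) + (12 * k + 9)                     ≡⟨ ring k ⟨
  base + (4 * (2 + k) + 10) * (8 * (2 + k) + 3)               ≤⟨ +-monoʳ-≤ base (*-monoˡ-≤ (8 * (2 + k) + 3)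
                                                                   (≤-trans (≤-reflexive (+-suc (4 * (2 + k)) 9)) 4ρ+9<s)) ⟩
  wichmannLength (2 + k) s                                    ≤⟨ m≤m+n _ δ ⟩
  wichmannLength (2 + k) s + δ                                ∎)
  where
    open ≤-Reasoning
    base : ℕ
    base = 16 * ((2 + k) * (2 + k)) + 16 * (2 + k) + 3
    ring : ∀ k → 16 * ((2 + k) * (2 + k)) + 16 * (2 + k) + 3 + (4 * (2 + k) + 10) * (8 * (2 + k) + 3) ≡
                 48 * ((3 + k) * (3 + k)) + (12 * k + 9)
    ring = solve-∀

gaps-lower : ∀ ρ s δ e → 48 * (ρ * ρ) ≤ wichmannLength ρ s + δ → δ + 1 ≤ (e + 1) * suc (2 * ρ) → 4 * ρ ≤ s + e + 3
gaps-lower ρ s δ e lo δ<⌈⌉ = ≮⇒≥ λ s+e+3<4ρ → 1+n≰n (+-cancelʳ-≤ (4 * (8 * ρ + 3)) (suc N) N (begin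
  suc N + 4 * (8 * ρ + 3)                                                 ≡⟨ cong (_+ 4 * (8 * ρ + 3)) (trans (+-comm 1 N) (+-assoc L δ 1)) ⟩
  L + (δ + 1) + 4 * (8 * ρ + 3)                                           ≤⟨ +-monoˡ-≤ (4 * (8 * ρ + 3)) (+-monoʳ-≤ L δ<⌈⌉) ⟩
  L + (e + 1) * suc (2 * ρ) + 4 * (8 * ρ + 3)                             ≤⟨ m≤m+n _ (e * (6 * ρ + 2)) ⟩
  L + (e + 1) * suc (2 * ρ) + 4 * (8 * ρ + 3) + e * (6 * ρ + 2)           ≡⟨ ring₁ ρ s e ⟩
  16 * (ρ * ρ) + 16 * ρ + 3 + (s + e + 4) * (8 * ρ + 3) + suc (2 * ρ)     ≤⟨ +-monoˡ-≤ (suc (2 * ρ)) (+-monoʳ-≤ (16 * (ρ * ρ) + 16 * ρ + 3)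
                                                                                (*-monoˡ-≤ (8 * ρ + 3) (≤-trans (≤-reflexive (+-suc (s + e) 3)) s+e+3<4ρ))) ⟩
  16 * (ρ * ρ) + 16 * ρ + 3 + 4 * ρ * (8 * ρ + 3) + suc (2 * ρ)           ≤⟨ m≤m+n _ (2 * ρ + 8) ⟩
  16 * (ρ * ρ) + 16 * ρ + 3 + 4 * ρ * (8 * ρ + 3) + suc (2 * ρ) + (2 * ρ + 8) ≡⟨ ring₂ ρ ⟩
  48 * (ρ * ρ) + 4 * (8 * ρ + 3)                                          ≤⟨ +-monoˡ-≤ (4 * (8 * ρ + 3)) lo ⟩
  N + 4 * (8 * ρ + 3)                                                     ∎))
  where
    open ≤-Reasoning
    L N : ℕ
    L = wichmannLength ρ s
    N = L + δ
    ring₁ : ∀ ρ s e → 16 * (ρ * ρ) + 16 * ρ + 3 + s * (8 * ρ + 3) + (e + 1) * suc (2 * ρ) + 4 * (8 * ρ + 3) + e * (6 * ρ + 2) ≡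
                      16 * (ρ * ρ) + 16 * ρ + 3 + (s + e + 4) * (8 * ρ + 3) + suc (2 * ρ)
    ring₁ = solve-∀
    ring₂ : ∀ ρ → 16 * (ρ * ρ) + 16 * ρ + 3 + 4 * ρ * (8 * ρ + 3) + suc (2 * ρ) + (2 * ρ + 8) ≡ 48 * (ρ * ρ) + 4 * (8 * ρ + 3)
    ring₂ = solve-∀

chord-bound : ∀ ρ s δ e → e ≤ 4 → suc (2 * ρ) * e ≤ δ + suc (2 * ρ) →
  (24 * ρ + 9) * (8 * ρ + s + e) ≤ 3 * (wichmannLength ρ s + δ) + (144 * (ρ * ρ) + 102 * ρ + 18)
chord-bound ρ s δ e e≤4 e≤⌈⌉ = +-cancelʳ-≤ 9 _ _ (begin
  (24 * ρ + 9) * (8 * ρ + s + e) + 9                                          ≡⟨ ring₁ ρ s e ⟩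
  3 * wichmannLength ρ s + (144 * (ρ * ρ) + 24 * ρ) + ((18 * ρ + 6) * e + 3 * (suc (2 * ρ) * e))
      ≤⟨ +-monoʳ-≤ (3 * wichmannLength ρ s + (144 * (ρ * ρ) + 24 * ρ)) (+-mono-≤ (*-monoʳ-≤ (18 * ρ + 6) e≤4) (*-monoʳ-≤ 3 e≤⌈⌉)) ⟩
  3 * wichmannLength ρ s + (144 * (ρ * ρ) + 24 * ρ) + ((18 * ρ + 6) * 4 + 3 * (δ + suc (2 * ρ)))
      ≡⟨ ring₂ ρ s δ ⟩
  3 * (wichmannLength ρ s + δ) + (144 * (ρ * ρ) + 102 * ρ + 18) + 9           ∎)
  where
    open ≤-Reasoning
    ring₁ : ∀ ρ s e → (24 * ρ + 9) * (8 * ρ + s + e) + 9 ≡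
      3 * (16 * (ρ * ρ) + 16 * ρ + 3 + s * (8 * ρ + 3)) + (144 * (ρ * ρ) + 24 * ρ) + ((18 * ρ + 6) * e + 3 * (suc (2 * ρ) * e))
    ring₁ = solve-∀
    ring₂ : ∀ ρ s δ → 3 * (16 * (ρ * ρ) + 16 * ρ + 3 + s * (8 * ρ + 3)) + (144 * (ρ * ρ) + 24 * ρ) + ((18 * ρ + 6) * 4 + 3 * (δ + suc (2 * ρ))) ≡
      3 * (16 * (ρ * ρ) + 16 * ρ + 3 + s * (8 * ρ + 3) + δ) + (144 * (ρ * ρ) + 102 * ρ + 18) + 9
    ring₂ = solve-∀

-- x ↦ (24ρ + 9) x − x² exceeds 144ρ² + 78ρ + 9 between its roots 12ρ + 9/2 ± √(30ρ + 45/4),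
-- an interval containing [12ρ − 4, 12ρ + 12] once ρ ≥ 3.
square-below-chord : ∀ ρ x → 3 ≤ ρ → 12 * ρ ≤ x + 4 → x + 4 ≤ 12 * ρ + 16 →
  x * x + (144 * (ρ * ρ) + 78 * ρ + 9) ≤ (24 * ρ + 9) * x
square-below-chord ρ x 3≤ρ lo hi with m≤n⇒∃[o]m+o≡n 3≤ρ | m≤n⇒∃[o]m+o≡n lo
... | k , refl | y , 12ρ+y≡x+4 = +-cancelʳ-≤ (30 * k + 29 + 17 * y) _ _ (begin
  x * x + C₀ + (30 * k + 29 + 17 * y)                         ≡⟨ cong (λ z → z * z + C₀ + (30 * k + 29 + 17 * y)) x≡ ⟩
  (12 * k + 32 + y) * (12 * k + 32 + y) + C₀ + (30 * k + 29 + 17 * y) ≡⟨ ring k y ⟩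
  (24 * (3 + k) + 9) * (12 * k + 32 + y) + y * y              ≤⟨ +-monoʳ-≤ _ (≤-trans (*-monoˡ-≤ y (m≤n⇒m≤1+n y≤16)) (m≤n+m (17 * y) (30 * k + 29))) ⟩
  (24 * (3 + k) + 9) * (12 * k + 32 + y) + (30 * k + 29 + 17 * y) ≡⟨ cong (λ z → (24 * (3 + k) + 9) * z + (30 * k + 29 + 17 * y)) x≡ ⟨
  (24 * (3 + k) + 9) * x + (30 * k + 29 + 17 * y)            ∎)
  where
    open ≤-Reasoning
    C₀ : ℕ
    C₀ = 144 * ((3 + k) * (3 + k)) + 78 * (3 + k) + 9
    y≤16 : y ≤ 16
    y≤16 = +-cancelˡ-≤ (12 * (3 + k)) y 16 (≤-trans (≤-reflexive 12ρ+y≡x+4) hi)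
    shift : ∀ k y → 12 * (3 + k) + y ≡ 12 * k + 32 + y + 4
    shift = solve-∀
    x≡ : x ≡ 12 * k + 32 + y
    x≡ = +-cancelʳ-≡ 4 x _ (trans (sym 12ρ+y≡x+4) (shift k y))
    ring : ∀ k y → (12 * k + 32 + y) * (12 * k + 32 + y) + (144 * ((3 + k) * (3 + k)) + 78 * (3 + k) + 9) + (30 * k + 29 + 17 * y) ≡
                   (24 * (3 + k) + 9) * (12 * k + 32 + y) + y * y
    ring = solve-∀

wichmann-inequality : ∀ ρ s δ e → 3 ≤ ρ →
  48 * (ρ * ρ) ≤ wichmannLength ρ s + δ → wichmannLength ρ s + δ < 48 * (suc ρ * suc ρ) →
  e ≤ 4 → suc (2 * ρ) * e ≤ δ + suc (2 * ρ) → δ + 1 ≤ (e + 1) * suc (2 * ρ) →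
  (8 * ρ + 3 + s + e ∸ 4) * (8 * ρ + 3 + s + e ∸ 4) ≤ 3 * (wichmannLength ρ s + δ)
wichmann-inequality ρ s δ e 3≤ρ lo hi e≤4 e≤⌈⌉ δ<⌈⌉ = +-cancelʳ-≤ C₀ (x * x) (3 * N) (begin
  x * x + C₀                        ≤⟨ square-below-chord ρ x 3≤ρ 12ρ≤x+4 x+4≤12ρ+16 ⟩
  (24 * ρ + 9) * x                 ≤⟨ +-cancelʳ-≤ (24 * ρ + 9) _ _ (begin
    (24 * ρ + 9) * x + (24 * ρ + 9)      ≡⟨ trans (+-comm _ (24 * ρ + 9)) (sym (*-suc (24 * ρ + 9) x)) ⟩
    (24 * ρ + 9) * suc x                 ≡⟨ cong ((24 * ρ + 9) *_) x+1≡ ⟩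
    (24 * ρ + 9) * (8 * ρ + s + e)       ≤⟨ chord-bound ρ s δ e e≤4 e≤⌈⌉ ⟩
    3 * N + (144 * (ρ * ρ) + 102 * ρ + 18) ≡⟨ split-constant ρ (3 * N) ⟩
    3 * N + C₀ + (24 * ρ + 9)             ∎) ⟩
  3 * N + C₀                        ∎)
  where
    open ≤-Reasoning
    N C₀ L x : ℕ
    N = wichmannLength ρ s + δ
    C₀ = 144 * (ρ * ρ) + 78 * ρ + 9
    L = 8 * ρ + 3 + s + e
    x = L ∸ 4
    4≤L : 4 ≤ L
    4≤L = ≤-trans (+-monoˡ-≤ 3 (≤-trans (s≤s z≤n) (*-monoʳ-≤ 8 (≤-trans (s≤s z≤n) 3≤ρ))))
                        (≤-trans (m≤m+n (8 * ρ + 3) s) (m≤m+n _ e))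
    x+4≡ : x + 4 ≡ L
    x+4≡ = m∸n+n≡m 4≤L
    ring₁ : ∀ x → suc x + 3 ≡ x + 4
    ring₁ = solve-∀
    ring₂ : ∀ ρ s e → 8 * ρ + 3 + s + e ≡ 8 * ρ + s + e + 3
    ring₂ = solve-∀
    ring₃ : ∀ ρ s e → 8 * ρ + (s + e + 3) ≡ 8 * ρ + 3 + s + e
    ring₃ = solve-∀
    x+1≡ : suc x ≡ 8 * ρ + s + e
    x+1≡ = +-cancelʳ-≡ 3 _ _ (trans (ring₁ x) (trans x+4≡ (ring₂ ρ s e)))
    12ρ≤x+4 : 12 * ρ ≤ x + 4
    12ρ≤x+4 = begin
      12 * ρ             ≡⟨ *-distribʳ-+ ρ 8 4 ⟩
      8 * ρ + 4 * ρ      ≤⟨ +-monoʳ-≤ (8 * ρ) (gaps-lower ρ s δ e lo δ<⌈⌉) ⟩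
      8 * ρ + (s + e + 3) ≡⟨ ring₃ ρ s e ⟩
      L            ≡⟨ x+4≡ ⟨
      x + 4              ∎
    x+4≤12ρ+16 : x + 4 ≤ 12 * ρ + 16
    x+4≤12ρ+16 = begin
      x + 4                         ≡⟨ x+4≡ ⟩
      L                       ≡⟨ ring₃ ρ s e ⟨
      8 * ρ + (s + e + 3)           ≤⟨ +-monoʳ-≤ (8 * ρ) (+-monoˡ-≤ 3 (+-mono-≤ (gaps-upper ρ s δ (≤-trans (n≤1+n 2) 3≤ρ) hi) e≤4)) ⟩
      8 * ρ + (4 * ρ + 9 + 4 + 3)   ≡⟨ ring₄ ρ ⟩
      12 * ρ + 16                   ∎
      where
        ring₄ : ∀ ρ → 8 * ρ + (4 * ρ + 9 + 4 + 3) ≡ 12 * ρ + 16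
        ring₄ = solve-∀
    split-constant : ∀ ρ T → T + (144 * (ρ * ρ) + 102 * ρ + 18) ≡ T + (144 * (ρ * ρ) + 78 * ρ + 9) + (24 * ρ + 9)
    split-constant = solve-∀

-- Choice of the parameters

IsScaledSqrt : ℕ → ℕ → ℕ → Set
IsScaledSqrt c N k = c * (k * k) ≤ N × N < c * (suc k * suc k)

private
  scaledSqrt-step : ℕ → ℕ → ℕ → ℕ
  scaledSqrt-step c N k = if does (c * (suc k * suc k) ≤? suc N) then suc k else k

scaledSqrt : ℕ → ℕ → ℕ
scaledSqrt c zero = 0
scaledSqrt c (suc N) = scaledSqrt-step c N (scaledSqrt c N)

scaledSqrt-spec : ∀ c N → IsScaledSqrt (suc c) N (scaledSqrt (suc c) N)
scaledSqrt-spec c zero = ≤-reflexive (*-zeroʳ (suc c)) , ≤-trans (s≤s z≤n) (m≤m*n (suc c) 1)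
scaledSqrt-spec c (suc N) = step (scaledSqrt (suc c) N) (scaledSqrt-spec c N)
  where
    step : ∀ k → IsScaledSqrt (suc c) N k → IsScaledSqrt (suc c) (suc N) (scaledSqrt-step (suc c) N k)
    step k (lo , hi) with suc c * (suc k * suc k) ≤? suc N
    ... | yes fits = subst (IsScaledSqrt (suc c) (suc N)) (sym (if-yes (_ ≤? suc N) fits))
      (fits , ≤-<-trans hi (*-monoʳ-< (suc c) (*-mono-< (n<1+n (suc k)) (n<1+n (suc k)))))
    ... | no too-big = subst (IsScaledSqrt (suc c) (suc N)) (sym (if-no (_ ≤? suc N) too-big))
      (≤-trans lo (n≤1+n N) , ≰⇒> too-big)

LettersBound : ℕ → ℕ → Set
LettersBound N L = (L ∸ 4) * (L ∸ 4) ≤ 3 * N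

bound-from-letters : ∀ N L → LettersBound N L → BoundHolds (suc N) (suc N ∸ L)
bound-from-letters N L bound = ≤-trans (*-mono-≤ excess≤ excess≤)
  (≤-trans bound (≤-reflexive (sym (trans (cong (_∸ 3) (*-suc 3 N)) (m+n∸m≡n 3 (3 * N))))))
  where
    open ≤-Reasoning
    m∸[m∸n]≤n : ∀ m n → m ∸ (m ∸ n) ≤ n
    m∸[m∸n]≤n m n with ≤-total n m
    ... | inj₁ n≤m = ≤-reflexive (m∸[m∸n]≡n n≤m)
    ... | inj₂ m≤n = ≤-trans (≤-reflexive (cong (m ∸_) (m≤n⇒m∸n≡0 m≤n))) m≤n
    excess≤ : suc N ∸ (suc N ∸ L + 4) ≤ L ∸ 4
    excess≤ = begin
      suc N ∸ (suc N ∸ L + 4)   ≡⟨ ∸-+-assoc (suc N) (suc N ∸ L) 4 ⟨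
      suc N ∸ (suc N ∸ L) ∸ 4   ≤⟨ ∸-monoˡ-≤ 4 (m∸[m∸n]≤n (suc N) L) ⟩
      L ∸ 4                     ∎

trivialLetters : ℕ → ℕ
trivialLetters N = suc r + extensionLetters r (N ∸ r)
  where
    r : ℕ
    r = scaledSqrt 1 N

trivial-HB4 : ∀ N → HB4-atLeast (suc N) (suc N ∸ trivialLetters N)
trivial-HB4 N = extend-core r r N initialBlock (suc r) (λ i _ → initialBlock-letter i (λ ()) (λ ())) ≤-refl r≤N
  (initialBlock-covers r) (letters-segment-≤ initialBlock 0 (suc r))
  where
    r : ℕ
    r = scaledSqrt 1 N
    m≤m*m : ∀ m → m ≤ m * m
    m≤m*m zero = z≤n
    m≤m*m (suc m) = m≤m*n (suc m) (suc m)
    r≤N : r ≤ N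
    r≤N = ≤-trans (m≤m*m r) (≤-trans (≤-reflexive (sym (+-identityʳ (r * r)))) (proj₁ (scaledSqrt-spec 0 N)))

wichmannR : ℕ → ℕ
wichmannR N = 2 * scaledSqrt 48 N

wichmannS : ℕ → ℕ
wichmannS N = (N ∸ Wichmann.N′ (wichmannR N) 0) / Wichmann.q (wichmannR N) 0

wichmannLetters : ℕ → ℕ
wichmannLetters N = 4 * r + 3 + s + extensionLetters r (N ∸ Wichmann.N′ r s)
  where
    r s : ℕ
    r = wichmannR N
    s = wichmannS N

module WichmannChoice (N : ℕ) where
  ρ r s : ℕ
  ρ = scaledSqrt 48 N
  r = wichmannR N
  s = wichmannS N

  ρ-spec : IsScaledSqrt 48 N ρ
  ρ-spec = scaledSqrt-spec 47 N

  length≡ : ∀ j → Wichmann.N′ r j ≡ wichmannLength ρ j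
  length≡ j = ring ρ j
    where
      ring : ∀ ρ s → suc (2 * ρ) * suc (2 * ρ + 2 * ρ) + s * (suc (2 * ρ + 2 * ρ) + suc (suc (2 * ρ + 2 * ρ))) +
                     suc (2 * ρ) * suc (suc (2 * ρ + 2 * ρ)) + 2 * ρ ≡ 16 * (ρ * ρ) + 16 * ρ + 3 + s * (8 * ρ + 3)
      ring = solve-∀

  q≡ : Wichmann.q r 0 ≡ 8 * ρ + 3
  q≡ = ring ρ
    where
      ring : ∀ ρ → suc (2 * ρ + 2 * ρ) + suc (suc (2 * ρ + 2 * ρ)) ≡ 8 * ρ + 3
      ring = solve-∀

  base≤N : 1 ≤ ρ → Wichmann.N′ r 0 ≤ N
  base≤N 1≤ρ with m≤n⇒∃[o]m+o≡n 1≤ρ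
  ... | k , 1+k≡ρ = begin
    Wichmann.N′ r 0                             ≡⟨ length≡ 0 ⟩
    wichmannLength ρ 0                          ≤⟨ m≤m+n _ _ ⟩
    wichmannLength ρ 0 + (32 * (k * k) + 48 * k + 13) ≡⟨ cong (λ n → wichmannLength n 0 + (32 * (k * k) + 48 * k + 13)) 1+k≡ρ ⟨
    wichmannLength (suc k) 0 + (32 * (k * k) + 48 * k + 13) ≡⟨ ring k ⟩
    48 * (suc k * suc k)                        ≡⟨ cong (λ n → 48 * (n * n)) 1+k≡ρ ⟩
    48 * (ρ * ρ)                                ≤⟨ proj₁ ρ-spec ⟩
    N                                           ∎
    where
      open ≤-Reasoning
      ring : ∀ k → 16 * (suc k * suc k) + 16 * suc k + 3 + 0 * (8 * suc k + 3) + (32 * (k * k) + 48 * k + 13) ≡ 48 * (suc k * suc k)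
      ring = solve-∀

  1≤ρ : 48 ≤ N → 1 ≤ ρ
  1≤ρ 48≤N = n≢0⇒n>0 λ ρ≡0 → <⇒≱ (subst (λ k → N < 48 * (suc k * suc k)) ρ≡0 (proj₂ ρ-spec)) 48≤N

  δ : ℕ
  δ = N ∸ Wichmann.N′ r s

  N′≡ : ∀ j → Wichmann.N′ r j ≡ Wichmann.N′ r 0 + j * Wichmann.q r 0
  N′≡ j = ring (Wichmann.P r j) (Wichmann.q r 0) (suc r * Wichmann.R r j) r j
    where
      ring : ∀ P q X r s → P + s * q + X + r ≡ P + 0 * q + X + r + s * q
      ring = solve-∀

  module _ (48≤N : 48 ≤ N) where

    N≡N′+rem : N ≡ Wichmann.N′ r s + (N ∸ Wichmann.N′ r 0) % Wichmann.q r 0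
    N≡N′+rem = begin
      N                                   ≡⟨ m+[n∸m]≡n (base≤N (1≤ρ 48≤N)) ⟨
      base + (N ∸ base)                   ≡⟨ cong (base +_) (m≡m%n+[m/n]*n (N ∸ base) q) ⟩
      base + ((N ∸ base) % q + s * q)     ≡⟨ x∙yz≈xz∙y base _ (s * q) ⟩
      base + s * q + (N ∸ base) % q       ≡⟨ cong (_+ (N ∸ base) % q) (N′≡ s) ⟨
      Wichmann.N′ r s + (N ∸ base) % q    ∎
      where
        open ≡-Reasoning
        base q : ℕ
        base = Wichmann.N′ r 0
        q = Wichmann.q r 0

    δ≡rem : δ ≡ (N ∸ Wichmann.N′ r 0) % Wichmann.q r 0
    δ≡rem = trans (cong (_∸ Wichmann.N′ r s) N≡N′+rem) (m+n∸m≡n (Wichmann.N′ r s) _)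

    N′≤N : Wichmann.N′ r s ≤ N
    N′≤N = ≤-trans (m≤m+n _ _) (≤-reflexive (sym N≡N′+rem))

    N≡ : N ≡ wichmannLength ρ s + δ
    N≡ = trans (sym (m+[n∸m]≡n N′≤N)) (cong (_+ δ) (length≡ s))

    δ<q : δ < 8 * ρ + 3
    δ<q = subst₂ _<_ (sym δ≡rem) q≡ (m%n<n (N ∸ Wichmann.N′ r 0) (Wichmann.q r 0))

wichmann-HB4 : ∀ N → 48 ≤ N → HB4-atLeast (suc N) (suc N ∸ wichmannLetters N)
wichmann-HB4 N 48≤N = extend-core r N′ N ruler (4 * r + 3 + s) (λ i i≤r → ruler-initial i i≤r (λ ()) (λ ()))
  (m≤n+m r E) (N′≤N 48≤N) ruler-covers ruler-letters
  where
    open WichmannChoice N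
    open Wichmann r s

large-bound : ∀ N → 432 ≤ N → LettersBound N (wichmannLetters N)
large-bound N 432≤N = subst₂ LettersBound (sym (N≡ 48≤N)) (cong (λ z → z + 3 + s + e) (*-assoc 4 2 ρ))
  (wichmann-inequality ρ s δ e 3≤ρ (subst (48 * (ρ * ρ) ≤_) (N≡ 48≤N) (proj₁ ρ-spec))
    (subst (_< 48 * (suc ρ * suc ρ)) (N≡ 48≤N) (proj₂ ρ-spec))
    (extensionLetters-≤ r δ 4 (<-trans (δ<q 48≤N) (≤-reflexive (ring ρ)))) (extensionLetters-upper r δ) (extensionLetters-lower r δ))
  where
    open WichmannChoice N
    e : ℕ
    e = extensionLetters r δ
    48≤N : 48 ≤ N
    48≤N = ≤-trans (m≤m+n 48 384) 432≤N
    3≤ρ : 3 ≤ ρ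
    3≤ρ = ≮⇒≥ λ ρ<3 → <⇒≱ (<-≤-trans (proj₂ ρ-spec) (*-monoʳ-≤ 48 (*-mono-≤ ρ<3 ρ<3))) 432≤N
    ring : ∀ ρ → suc (8 * ρ + 3) ≡ 4 * suc (2 * ρ)
    ring = solve-∀

-- The Wichmann word needs N ≥ 200: it is one letter too long at N = 188.
chosenLetters : ℕ → ℕ
chosenLetters N = if does (N <? 200) then trivialLetters N else wichmannLetters N

small-bound : ∀ N → N < 432 → LettersBound N (chosenLetters N)
small-bound N N<432 = subst (λ n → LettersBound n (chosenLetters n)) (toℕ-fromℕ< N<432) (checked (fromℕ< N<432))
  where
    checked : ∀ (i : Fin 432) → LettersBound (toℕ i) (chosenLetters (toℕ i))
    checked = toWitness {a? = all? λ i → _ ≤? _} _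

chosen-HB4 : ∀ N → HB4-atLeast (suc N) (suc N ∸ chosenLetters N)
chosen-HB4 N with N <? 200
... | yes N<200 = subst (λ L → HB4-atLeast (suc N) (suc N ∸ L)) (sym (if-yes (N <? 200) N<200)) (trivial-HB4 N)
... | no N≮200 = subst (λ L → HB4-atLeast (suc N) (suc N ∸ L)) (sym (if-no (N <? 200) N≮200))
  (wichmann-HB4 N (≤-trans (m≤m+n 48 152) (≮⇒≥ N≮200)))

chosen-bound : ∀ N → LettersBound N (chosenLetters N)
chosen-bound N with N <? 432
... | yes N<432 = small-bound N N<432
... | no N≮432 = subst (LettersBound N) (sym (if-no (N <? 200) λ N<200 → N≮432 (<-trans N<200 (m<m+n 200 z<s))))
  (large-bound N (≮⇒≥ N≮432))

theorem9 : (n : ℕ) → 1 ≤ n →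
    Σ ℕ λ h → HB4-atLeast n h × BoundHolds n h
theorem9 (suc N) _ = suc N ∸ chosenLetters N , chosen-HB4 N , bound-from-letters N (chosenLetters N) (chosen-bound N)
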